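{- For every regular spanner $P$, the spanner relation $R^P$ can be maintained in $\mathsf{DynPROP}$.
   Context: Spanners: for $w=a_1\cdots a_n\in\Sigma^*$ a span $[i,j\rangle$ ($1\le i\le j\le n+1$) denotes $a_i\cdots a_{j-1}$; a spanner $P$ with variable set $\mathrm{SVars}(P)=V$ maps $w$ to a set $P(w)$ of functions $\mu$ from $V$ to spans of $w$. Regular spanners are those defined by regex formulas (regular expressions with variable bindings $x\{\gamma\}$, each variable bound exactly once per match) closed under union, projection and natural join; equivalently by variable-set automata. Dynamic setting: a word-structure $\mathfrak W$ has domain $D=\{1,\dots,n+1\}$ with the natural order $<$, constant $\$=n+1$, and unary relations $P_a$ ($a\in\Sigma$) such that each $i\le n$ is in at most one $P_a$ and $\$$ in none; $w[i]=a$ if $P_a(i)$, else $w[i]=\varepsilon$; $\mathrm{word}(\mathfrak W)=w[1]\cdots w[n]$. $i$ is a symbol-element if $w[i]\ne\varepsilon$; for a symbol-element $x$, $\mathrm{pos}(x)$ is the number of symbol-elements $\le x$. Updates: $\mathrm{ins}_a(i)$ ($i\neq\$$, allowed if $w[i]\ne a$) sets $w[i]=a$; $\mathrm{reset}(i)$ (allowed if $w[i]\ne\varepsilon$) sets $w[i]=\varepsilon$. A dynamic program consists of auxiliary relations over $D$, initialized by first-order formulas on the initially empty word structure, and for every auxiliary relation $R$ of arity $k$ and update type $\mathsf{op}\in\{\mathrm{ins}_a:a\in\Sigma\}\cup\{\mathrm{reset}\}$ an update formula $\phi^R_{\mathsf{op}}(u;x_1,\dots,x_k)$ over $<,\$,P_a$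 and the auxiliary relations; after $\mathsf{op}(i)$, $R$ becomes the set of $\bar j$ such that the updated word structure with the old auxiliary relations satisfies $\phi^R_{\mathsf{op}}(i;\bar j)$. A relation is maintained if a designated auxiliary relation equals it after every sequence of updates (for every $n$). $\mathsf{DynPROP}$: all update formulas quantifier-free. Spanner relation: for $P$ with $\mathrm{SVars}(P)=\{x_1,\dots,x_k\}$, $R^P$ is the $2k$-ary relation over $D$ containing, for each $\mu\in P(\mathrm{word}(\mathfrak W))$, the tuple $(\hat x_1,\check x_1,\dots,\hat x_k,\check x_k)$ with $\mu(x_i)=[\mathrm{pos}(\hat x_i),\mathrm{pos}(\check x_i)\rangle$, except that if $\mu(x_i)=[j,|w|+1\rangle$ then $\check x_i=\$$. -}

module Defs where

open import Data.Nat using (ℕ; zero; suc; _+_; _*_)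
open import Data.Fin using (Fin; zero; suc; fromℕ; _≟_; _≤?_) renaming (_<_ to _<ᶠ_)
open import Data.List using (allFin)
open import Data.List using (List; []; _∷_; _++_; length; mapMaybe)
open import Data.List.Membership.Propositional using (_∉_)
open import Data.Maybe using (Maybe; just; nothing)
open import Data.Bool using (Bool; true; false; T; if_then_else_)
open import Data.Product using (Σ; ∃; _×_; _,_; proj₁; proj₂)
open import Data.Sum using (_⊎_)
open import Data.Unit using (⊤)
open import Data.Empty using (⊥)
open import Relation.Nullary using (¬_; does)
open import Relation.Binary.PropositionalEquality using (_≡_; _≢_; subst; sym)
open import Function.Bundles using (_⇔_)

-- Spanners, given by variable-set automata.
-- Alphabet Σ = Fin s, span variables x₁..x_k = Fin k.
-- A span [i,j⟩ is represented by the pair (i , j) of naturals (1-based).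

Span : Set
Span = ℕ × ℕ

data RefSym (s k : ℕ) : Set where
  lsym : Fin s → RefSym s k
  opn : Fin k → RefSym s k
  cls : Fin k → RefSym s k

nLetters : ∀ {s k} → List (RefSym s k) → ℕ
nLetters [] = 0
nLetters (lsym _ ∷ r) = suc (nLetters r)
nLetters (opn _ ∷ r) = nLetters r
nLetters (cls _ ∷ r) = nLetters r

clr : ∀ {s k} → List (RefSym s k) → List (Fin s)
clr [] = []
clr (lsym a ∷ r) = a ∷ clr r
clr (opn _ ∷ r) = clr r
clr (cls _ ∷ r) = clr r

-- Variable-set automaton (with ε-transitions): transitions labelled by
-- nothing (ε) or by a ref-word symbol.
record VSA (s k : ℕ) : Set where
  field
    nStates : ℕ
    start   : Fin nStates
    final   : Fin nStates → Bool
    δ       : Fin nStates → Maybe (RefSym s k) → Fin nStates → Bool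

data Path {s k} (A : VSA s k) : Fin (VSA.nStates A) → List (RefSym s k) → Fin (VSA.nStates A) → Set where
  here  : ∀ {p} → Path A p [] p
  epsS  : ∀ {p p' p'' r} → T (VSA.δ A p nothing p') → Path A p' r p'' → Path A p r p''
  symS  : ∀ {p p' p'' c r} → T (VSA.δ A p (just c) p') → Path A p' r p'' → Path A p (c ∷ r) p''

Accepts : ∀ {s k} → VSA s k → List (RefSym s k) → Set
Accepts A r = Σ (Fin (VSA.nStates A)) λ q → Path A (VSA.start A) r q × T (VSA.final A q)

VarSpan : ∀ {s k} → List (RefSym s k) → Fin k → Span → Set
VarSpan {s} {k} r x (i , j) =
  Σ (List (RefSym s k)) λ r₁ → Σ (List (RefSym s k)) λ r₂ → Σ (List (RefSym s k)) λ r₃ →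
    (r ≡ r₁ ++ (opn x ∷ r₂ ++ (cls x ∷ r₃)))
    × (opn x ∉ r₁ ++ r₂ ++ r₃) × (cls x ∉ r₁ ++ r₂ ++ r₃)
    × (i ≡ suc (nLetters r₁)) × (j ≡ suc (nLetters r₁ + nLetters r₂))

⟦_⟧ : ∀ {s k} → VSA s k → List (Fin s) → (Fin k → Span) → Set
⟦_⟧ {s} {k} A w μ = Σ (List (RefSym s k)) λ r →
  Accepts A r × (clr r ≡ w) × (∀ x → VarSpan r x (μ x))

-- Word structures.  Domain D = {1,…,n+1} is Fin (suc n); $ = fromℕ n.

Dom : ℕ → Set
Dom n = Fin (suc n)

dollar : ∀ n → Dom n
dollar n = fromℕ n

-- contents: w[i] = just a  iff  P_a(i);  nothing = ε
WordS : ℕ → ℕ → Set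
WordS s n = Dom n → Maybe (Fin s)

emptyW : ∀ {s n} → WordS s n
emptyW _ = nothing

word : ∀ {s n} → WordS s n → List (Fin s)
word {n = n} w = mapMaybe w (allFin (suc n))

pos : ∀ {s n} → WordS s n → Dom n → ℕ
pos {n = n} w d = length (mapMaybe (λ i → if does (i ≤? d) then w i else nothing) (allFin (suc n)))

IsSymbol : ∀ {s n} → WordS s n → Dom n → Set
IsSymbol w d = w d ≢ nothing

-- splitting a 2k-tuple (x̂₁, x̌₁, …, x̂_k, x̌_k) into k pairs
pairs : ∀ {X : Set} k → (Fin (k * 2) → X) → Fin k → X × X
pairs (suc k) t zero = t zero , t (suc zero)
pairs (suc k) t (suc i) = pairs k (λ j → t (suc (suc j))) i

SpannerRel : ∀ {s k n} → VSA s k → WordS s n → (Fin (k * 2) → Dom n) → Set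
SpannerRel {s} {k} {n} A w t =
  Σ (Fin k → Span) λ μ → ⟦ A ⟧ (word w) μ ×
    (∀ x → let (xh , xc) = pairs k t x ; (i , j) = μ x in
       (IsSymbol w xh × pos w xh ≡ i)
       × ((IsSymbol w xc × pos w xc ≡ j) ⊎ (j ≡ suc (length (word w)) × xc ≡ dollar n)))

data Term (m : ℕ) : Set where
  var : Fin m → Term m
  $t  : Term m

data Formula (s τ : ℕ) (ar : Fin τ → ℕ) : ℕ → Set where
  tt  : ∀ {m} → Formula s τ ar m
  lt  : ∀ {m} → Term m → Term m → Formula s τ ar m
  eq  : ∀ {m} → Term m → Term m → Formula s τ ar m
  P   : ∀ {m} → Fin s → Term m → Formula s τ ar m
  rel : ∀ {m} (r : Fin τ) → (Fin (ar r) → Term m) → Formula s τ ar m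
  neg : ∀ {m} → Formula s τ ar m → Formula s τ ar m
  and : ∀ {m} → Formula s τ ar m → Formula s τ ar m → Formula s τ ar m
  or  : ∀ {m} → Formula s τ ar m → Formula s τ ar m → Formula s τ ar m
  ex  : ∀ {m} → Formula s τ ar (suc m) → Formula s τ ar m
  all : ∀ {m} → Formula s τ ar (suc m) → Formula s τ ar m

data QF {s τ ar} : ∀ {m} → Formula s τ ar m → Set where
  tt  : ∀ {m} → QF (tt {m = m})
  lt  : ∀ {m} {t u : Term m} → QF (lt t u)
  eq  : ∀ {m} {t u : Term m} → QF (eq t u)
  P   : ∀ {m} {a} {t : Term m} → QF (P a t)
  rel : ∀ {m} {r} {ts : Fin (ar r) → Term m} → QF (rel r ts)
  neg : ∀ {m} {φ : Formula s τ ar m} → QF φ → QF (neg φ)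
  and : ∀ {m} {φ ψ : Formula s τ ar m} → QF φ → QF ψ → QF (and φ ψ)
  or  : ∀ {m} {φ ψ : Formula s τ ar m} → QF φ → QF ψ → QF (or φ ψ)

AuxRels : ℕ → (τ : ℕ) → (Fin τ → ℕ) → Set₁
AuxRels n τ ar = (r : Fin τ) → (Fin (ar r) → Dom n) → Set

extend : ∀ {n m} → Dom n → (Fin m → Dom n) → Fin (suc m) → Dom n
extend d ρ zero = d
extend d ρ (suc i) = ρ i

evalT : ∀ {n m} → (Fin m → Dom n) → Term m → Dom n
evalT ρ (var i) = ρ i
evalT {n} ρ $t = dollar n

Sat : ∀ {s τ ar n m} → WordS s n → AuxRels n τ ar → Formula s τ ar m → (Fin m → Dom n) → Set
Sat w R tt ρ = ⊤
Sat w R (lt t u) ρ = evalT ρ t <ᶠ evalT ρ u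
Sat w R (eq t u) ρ = evalT ρ t ≡ evalT ρ u
Sat w R (P a t) ρ = w (evalT ρ t) ≡ just a
Sat w R (rel r ts) ρ = R r (λ j → evalT ρ (ts j))
Sat w R (neg φ) ρ = ¬ Sat w R φ ρ
Sat w R (and φ ψ) ρ = Sat w R φ ρ × Sat w R ψ ρ
Sat w R (or φ ψ) ρ = Sat w R φ ρ ⊎ Sat w R ψ ρ
Sat {n = n} w R (ex φ) ρ = Σ (Dom n) λ d → Sat w R φ (extend d ρ)
Sat {n = n} w R (all φ) ρ = (d : Dom n) → Sat w R φ (extend d ρ)

data Op (s : ℕ) : Set where
  ins   : Fin s → Op s
  reset : Op s

Allowed : ∀ {s n} → WordS s n → Op s → Dom n → Set
Allowed {n = n} w (ins a) i = (i ≢ dollar n) × (w i ≢ just a)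
Allowed w reset i = w i ≢ nothing

applyW : ∀ {s n} → WordS s n → Op s → Dom n → WordS s n
applyW w (ins a) i j = if does (j ≟ i) then just a else w j
applyW w reset i j = if does (j ≟ i) then nothing else w j

noAux : Fin 0 → ℕ
noAux ()

noRels : ∀ {n} → AuxRels n 0 noAux
noRels ()

record DynProg (s : ℕ) : Set where
  field
    τ    : ℕ
    ar   : Fin τ → ℕ
    init : (r : Fin τ) → Formula s 0 noAux (ar r)
    -- update formulas φ^R_op(u; x₁,…,x_k): variable zero is u
    upd  : Op s → (r : Fin τ) → Formula s τ ar (suc (ar r))

  initAux : ∀ n → AuxRels n τ ar
  initAux n r t = Sat {n = n} emptyW noRels (init r) t

  applyAux : ∀ {n} → WordS s n → AuxRels n τ ar → Op s → Dom n → AuxRels n τ ar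
  applyAux w R op i r t = Sat (applyW w op i) R (upd op r) (extend i t)

data Reach {s} (Π : DynProg s) (n : ℕ) : WordS s n → AuxRels n (DynProg.τ Π) (DynProg.ar Π) → Set₁ where
  initial : Reach Π n emptyW (DynProg.initAux Π n)
  step    : ∀ {w R} (op : Op s) (i : Dom n) → Reach Π n w R → Allowed w op i →
            Reach Π n (applyW w op i) (DynProg.applyAux Π w R op i)

IsDynPROP : ∀ {s} → DynProg s → Set
IsDynPROP Π = ∀ op r → QF (DynProg.upd Π op r)

Maintains : ∀ {s} k → DynProg s → (∀ {n} → WordS s n → (Fin (k * 2) → Dom n) → Set) → Set₁
Maintains k Π Q =
  Σ (Fin (DynProg.τ Π)) λ out → Σ (DynProg.ar Π out ≡ k * 2) λ e →
    ∀ n w R → Reach Π n w R → ∀ (t : Fin (k * 2) → Dom n) →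
      R out (subst (λ m → Fin m → Dom n) (sym e) t) ⇔ Q w t

MaintainableInDynPROP : ∀ s k → (∀ {n} → WordS s n → (Fin (k * 2) → Dom n) → Set) → Set₁
MaintainableInDynPROP s k Q = Σ (DynProg s) λ Π → IsDynPROP Π × Maintains k Π Q

-- For every pair of states p, q of the variable-set automaton the program keeps the relation
-- "reading the word structure strictly between x and y, with the opening and closing operations
-- of every variable placed at the elements named by the tuple t̄, the automaton can go from p to q",
-- plus its variants running from the start up to y and from x to an accepting state at $.  An
-- update at u leaves every interval avoiding u unchanged; an interval containing u splits into the
-- part before u, the single element u and the part after u, and whether the automaton can cross u
-- depends only on the new letter and on which entries of t̄ equal u.  These finitely many cases are
-- enumerated by a quantifier-free formula, and the spanner relation itself is recomputed the same
-- way from the prefix relation up to u and the suffix relation after u.  On the initial empty word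
-- all these relations are first-order definable from the order, ε-reachability of the automaton
-- being decidable.  Finally, a run through all elements with the operations placed according to t̄
-- is the same thing as an accepting ref-word whose spans are given by the positions of the
-- symbol-elements that t̄ names.

module Submission where

open import Defs

import Data.Nat.Properties as ℕₚ

open import Algebra.Properties.Monoid.Sum ℕₚ.+-0-monoid using (sum; sum-cong-≗)
open import Data.Bool using (Bool; true; false; T; if_then_else_)
import Data.Bool.Properties as Boolₚ
open import Data.Empty using (⊥; ⊥-elim)
open import Data.Fin as Fin using (Fin; zero; suc; toℕ)
import Data.Fin.Properties as Finₚ
open import Data.Fin.Subset using (Subset; _∈_; _⊆_; _⊂_; _∪_; ⁅_⁆; ∣_∣)
open import Data.Fin.Subset.Properties using (_∈?_; _⊂?_; p⊆p∪q; x∈p∪q⁺; x∈p∪q⁻; x∈⁅x⁆; x∈⁅y⁆⇒x≡y; ∣p∣≤n; p⊂q⇒∣p∣<∣q∣)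
open import Data.List using (List; []; _∷_; _++_; length; map; filter; fromMaybe; catMaybes; mapMaybe; allFin) renaming (tabulate to tabulateˡ)
open import Data.List.Properties using (filter-accept; filter-reject; filter-++; filter-all; filter-none; ++-cancelˡ; map-injective; ≡-dec; ++-identityʳ; ++-assoc; length-++; map-tabulate)
open import Data.List.Relation.Unary.All as All using (All; []; _∷_)
open import Data.List.Relation.Unary.All.Properties using (map⁺; ++⁺; filter⁺)
open import Data.List.Relation.Unary.Any using (here; there)
open import Data.List.Membership.Propositional using (_∉_)
open import Data.List.Membership.Propositional.Properties using (++-∈⇔)
open import Data.Maybe using (Maybe; just; nothing)
open import Data.Nat as ℕ using (ℕ; zero; suc; _+_; _*_; _∸_; z≤n; s≤s)
open import Data.Product using (Σ-syntax; ∃-syntax; _×_; _,_; proj₁; proj₂)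
open import Data.Product.Properties using (×-≡,≡→≡)
open import Data.Sum as Sum using (_⊎_; inj₁; inj₂; [_,_]′)
open import Data.Unit using (⊤; tt)
open import Data.Vec using (tabulate)
open import Data.Vec.Properties using (lookup⇒[]=; []=⇒lookup; lookup∘tabulate)
open import Function using (_∘_; id; case_of_)
open import Function.Bundles using (_⇔_; mk⇔; Equivalence)
open import Data.Product.Function.NonDependent.Propositional using (_×-⇔_)
open import Relation.Binary.Construct.Closure.ReflexiveTransitive using (Star; ε; _◅_; _◅◅_)
open import Relation.Binary.PropositionalEquality
open import Relation.Nullary using (Dec; yes; no; does; proof; ¬_; contradiction)
open import Relation.Nullary.Reflects using (Reflects; invert)
open import Relation.Nullary.Decidable using (_×-dec_; dec-true; dec-false; map′; T?)

open import Function.Properties.Equivalence using () renaming (sym to ⇔-sym; trans to ⇔-trans)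

open Equivalence using (to; from)

sum-const : ∀ m c → sum {m} (λ _ → c) ≡ m * c
sum-const zero c = refl
sum-const (suc m) c = cong (c +_) (sum-const m c)

sum-mono-≤ : ∀ {m} {f g : Fin m → ℕ} → (∀ x → f x ℕ.≤ g x) → sum f ℕ.≤ sum g
sum-mono-≤ {zero} f≤g = z≤n
sum-mono-≤ {suc m} f≤g = ℕₚ.+-mono-≤ (f≤g zero) (sum-mono-≤ (f≤g ∘ suc))

sum-bump : ∀ {m} (y : Fin m) {f g : Fin m → ℕ} →
           f y ≡ suc (g y) → (∀ x → x ≢ y → f x ≡ g x) → sum f ≡ suc (sum g)
sum-bump zero fy f≡g = cong₂ _+_ fy (sum-cong-≗ λ x → f≡g (suc x) λ ())
sum-bump (suc y) {g = g} fy f≡g =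
  trans (cong₂ _+_ (f≡g zero λ ()) (sum-bump y fy λ x x≢y → f≡g (suc x) (x≢y ∘ Finₚ.suc-injective)))
        (ℕₚ.+-suc (g zero) _)

∸-split : ∀ {a u b} → a ℕ.≤ u → u ℕ.≤ b → b ∸ a ≡ (u ∸ a) + (b ∸ u)
∸-split {a} {u} {b} a≤u u≤b = ℕₚ.+-cancelˡ-≡ a _ _ (begin
  a + (b ∸ a)               ≡⟨ ℕₚ.m+[n∸m]≡n (ℕₚ.≤-trans a≤u u≤b) ⟩
  b                         ≡⟨ ℕₚ.m+[n∸m]≡n u≤b ⟨
  u + (b ∸ u)               ≡⟨ cong (_+ (b ∸ u)) (ℕₚ.m+[n∸m]≡n a≤u) ⟨
  a + (u ∸ a) + (b ∸ u)     ≡⟨ ℕₚ.+-assoc a _ _ ⟩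
  a + ((u ∸ a) + (b ∸ u))   ∎)
  where open ≡-Reasoning

<-+∸⇔< : ∀ {a b i} → a ℕ.≤ i → (i ℕ.< a + (b ∸ a)) ⇔ (i ℕ.< b)
<-+∸⇔< {a} {b} {i} a≤i = mk⇔ to′ (λ i<b → subst (i ℕ.<_) (sym (ℕₚ.m+[n∸m]≡n (ℕₚ.≤-trans a≤i (ℕₚ.<⇒≤ i<b)))) i<b)
  where
  to′ : i ℕ.< a + (b ∸ a) → i ℕ.< b
  to′ i< with a ℕ.≤? b
  ... | yes a≤b = subst (i ℕ.<_) (ℕₚ.m+[n∸m]≡n a≤b) i<
  ... | no a≰b = contradiction (subst (i ℕ.<_) (trans (cong (a +_) (ℕₚ.m≤n⇒m∸n≡0 (ℕₚ.<⇒≤ (ℕₚ.≰⇒> a≰b)))) (ℕₚ.+-identityʳ a)) i<)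
                               (ℕₚ.≤⇒≯ a≤i)

T-does : ∀ {P : Set} (d : Dec P) → T (does d) ⇔ P
T-does (yes p) = mk⇔ (λ _ → p) (λ _ → tt)
T-does (no ¬p) = mk⇔ (λ ()) ¬p

does-≟-toℕ : ∀ {m} (a b : Fin m) → does (a Fin.≟ b) ≡ does (toℕ a ℕ.≟ toℕ b)
does-≟-toℕ a b with a Fin.≟ b
... | yes refl = sym (dec-true (toℕ a ℕ.≟ toℕ a) refl)
... | no a≢b = sym (dec-false (toℕ a ℕ.≟ toℕ b) (a≢b ∘ Finₚ.toℕ-injective))

Fin-≤⇔<⊎≡ : ∀ {m} {a b : Fin m} → (a Fin.≤ b) ⇔ (a Fin.< b ⊎ a ≡ b)
Fin-≤⇔<⊎≡ = mk⇔ (λ a≤b → [ inj₁ , inj₂ ∘ Finₚ.toℕ-injective ]′ (ℕₚ.m≤n⇒m<n∨m≡n a≤b))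
                [ ℕₚ.<⇒≤ , (λ { refl → ℕₚ.≤-refl }) ]′

⇔-by-cases : ∀ {C X Y S : Set} → Dec C → (C → X ⇔ S) → (¬ C → Y ⇔ S) → ((C × X) ⊎ (¬ C × Y)) ⇔ S
⇔-by-cases (yes c) if-c if-¬c = mk⇔ [ (λ (_ , x) → to (if-c c) x) , (λ (¬c , _) → contradiction c ¬c) ]′
                                    (λ s → inj₁ (c , from (if-c c) s))
⇔-by-cases (no ¬c) if-c if-¬c = mk⇔ [ (λ (c , _) → contradiction c ¬c) , (λ (_ , y) → to (if-¬c ¬c) y) ]′
                                    (λ s → inj₂ (¬c , from (if-¬c ¬c) s))

∃²-cong : ∀ {I : Set} {L L′ Rr Rr′ : I → Set} {B : I → I → Set} → (∀ r → L r ⇔ L′ r) → (∀ r → Rr r ⇔ Rr′ r) →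
          (∃[ r ] ∃[ r′ ] L r × B r r′ × Rr r′) ⇔ (∃[ r ] ∃[ r′ ] L′ r × B r r′ × Rr′ r′)
∃²-cong L⇔ Rr⇔ = mk⇔ (λ (r , r′ , l , b , rr) → r , r′ , to (L⇔ r) l , b , to (Rr⇔ r′) rr)
                     (λ (r , r′ , l , b , rr) → r , r′ , from (L⇔ r) l , b , from (Rr⇔ r′) rr)

++-split-at-index : ∀ {X : Set} c {xs₁ xs₂ ys₁ ys₂ : List (X × ℕ)} →
  All ((_≡ c) ∘ proj₂) xs₁ → All ((_≡ c) ∘ proj₂) xs₂ → All ((c ℕ.<_) ∘ proj₂) ys₁ → All ((c ℕ.<_) ∘ proj₂) ys₂ →
  xs₁ ++ ys₁ ≡ xs₂ ++ ys₂ → xs₁ ≡ xs₂ × ys₁ ≡ ys₂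
++-split-at-index c {xs₁} {xs₂} {ys₁} {ys₂} at₁ at₂ after₁ after₂ split≡ = xs₁≡xs₂ , ++-cancelˡ xs₂ ys₁ ys₂ (subst (λ xs → xs ++ ys₁ ≡ xs₂ ++ ys₂) xs₁≡xs₂ split≡)
  where
  atIndex? = λ (p : _ × ℕ) → proj₂ p ℕ.≟ c
  keep : ∀ {xs ys} → All ((_≡ c) ∘ proj₂) xs → All ((c ℕ.<_) ∘ proj₂) ys → filter atIndex? (xs ++ ys) ≡ xs
  keep {xs} {ys} at after = begin
    filter atIndex? (xs ++ ys)                 ≡⟨ filter-++ atIndex? xs ys ⟩
    filter atIndex? xs ++ filter atIndex? ys   ≡⟨ cong₂ _++_ (filter-all atIndex? at) (filter-none atIndex? (All.map (λ c<i i≡c → ℕₚ.<⇒≢ c<i (sym i≡c)) after)) ⟩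
    xs ++ []                                   ≡⟨ ++-identityʳ xs ⟩
    xs                                         ∎
    where open ≡-Reasoning
  xs₁≡xs₂ : xs₁ ≡ xs₂
  xs₁≡xs₂ = trans (sym (keep at₁ after₁)) (trans (cong (filter atIndex?) split≡) (keep at₂ after₂))

-- Reachability in a finite decidable graph

module DecidableStar {N : ℕ} (_⟶_ : Fin N → Fin N → Set) (_⟶?_ : ∀ a b → Dec (a ⟶ b)) where

  Closed : Subset N → Set
  Closed X = ∀ {a b} → a ∈ X → a ⟶ b → b ∈ X

  ReachableFrom : Fin N → Subset N → Set
  ReachableFrom p X = ∀ {q} → q ∈ X → Star _⟶_ p q

  successors : Subset N → Subset N
  successors X = tabulate λ b → does (Finₚ.any? λ a → a ∈? X ×-dec a ⟶? b)

  successors⁺ : ∀ {X a b} → a ∈ X → a ⟶ b → b ∈ successors X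
  successors⁺ {X} {a} {b} a∈X a⟶b =
    lookup⇒[]= b _ (trans (lookup∘tabulate _ b) (dec-true (Finₚ.any? _) (a , a∈X , a⟶b)))

  successors⁻ : ∀ {X b} → b ∈ successors X → ∃[ a ] a ∈ X × a ⟶ b
  successors⁻ {X} {b} b∈ =
    invert (subst (Reflects _) (trans (sym (lookup∘tabulate _ b)) ([]=⇒lookup b∈)) (proof (Finₚ.any? _)))

  grow : Subset N → Subset N
  grow X = X ∪ successors X

  grow-reachable : ∀ {p X} → ReachableFrom p X → ReachableFrom p (grow X)
  grow-reachable {X = X} reach q∈ with x∈p∪q⁻ X _ q∈
  ... | inj₁ q∈X = reach q∈X
  ... | inj₂ q∈succ with successors⁻ q∈succ
  ...   | a , a∈X , a⟶q = reach a∈X ◅◅ (a⟶q ◅ ε)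

  ⊂-bound : ∀ {m fuel} {X Y : Subset N} → X ⊂ Y → m ℕ.≤ ∣ X ∣ + suc fuel → m ℕ.≤ ∣ Y ∣ + fuel
  ⊂-bound {fuel = fuel} {X} X⊂Y bound =
    ℕₚ.≤-trans bound (ℕₚ.≤-trans (ℕₚ.≤-reflexive (ℕₚ.+-suc ∣ X ∣ fuel)) (ℕₚ.+-monoˡ-≤ fuel (p⊂q⇒∣p∣<∣q∣ X⊂Y)))

  -- Each round either closes X or strictly enlarges it, so N rounds suffice.
  saturate : ∀ {p} fuel X → N ℕ.≤ ∣ X ∣ + fuel → ReachableFrom p X →
             Σ[ Y ∈ Subset N ] X ⊆ Y × Closed Y × ReachableFrom p Y
  saturate fuel X bound reach with X ⊂? grow X
  ... | no X⊄grow = X , id , closed , reach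
    where
    closed : Closed X
    closed {a} {b} a∈X a⟶b with b ∈? X
    ... | yes b∈X = b∈X
    ... | no b∉X = contradiction {A = X ⊂ grow X} (p⊆p∪q _ , b , x∈p∪q⁺ (inj₂ (successors⁺ a∈X a⟶b)) , b∉X) X⊄grow
  saturate zero X bound reach | yes X⊂grow =
    contradiction (ℕₚ.<-≤-trans (ℕₚ.≤-<-trans (subst (N ℕ.≤_) (ℕₚ.+-identityʳ _) bound) (p⊂q⇒∣p∣<∣q∣ X⊂grow)) (∣p∣≤n (grow X)))
                  (ℕₚ.<-irrefl refl)
  saturate (suc fuel) X bound reach | yes X⊂grow
    with Y , grow⊆Y , closed , reachY ← saturate fuel (grow X) (⊂-bound X⊂grow bound) (grow-reachable reach)
    = Y , grow⊆Y ∘ p⊆p∪q _ , closed , reachY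

  closed-star : ∀ {X a b} → Closed X → a ∈ X → Star _⟶_ a b → b ∈ X
  closed-star closed a∈X ε = a∈X
  closed-star closed a∈X (a⟶ ◅ path) = closed-star closed (closed a∈X a⟶) path

  ⁅⁆-reachable : ∀ p → ReachableFrom p ⁅ p ⁆
  ⁅⁆-reachable p q∈ rewrite x∈⁅y⁆⇒x≡y p q∈ = ε

  star? : ∀ p q → Dec (Star _⟶_ p q)
  star? p q with Y , p⊆Y , closed , reach ← saturate N ⁅ p ⁆ (ℕₚ.m≤n+m N _) (⁅⁆-reachable p)
    = map′ reach (closed-star closed (p⊆Y (x∈⁅x⁆ p))) (q ∈? Y)

-- Ref-words and variable-set automata

openIx closeIx : ∀ {k} → Fin k → Fin (k * 2)
openIx zero = zero
openIx (suc x) = suc (suc (openIx x))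
closeIx zero = suc zero
closeIx (suc x) = suc (suc (closeIx x))

pairs-ix : ∀ {X : Set} k (t : Fin (k * 2) → X) x → pairs k t x ≡ (t (openIx x) , t (closeIx x))
pairs-ix (suc k) t zero = refl
pairs-ix (suc k) t (suc x) = pairs-ix k (λ j → t (suc (suc j))) x

openIx-or-closeIx : ∀ {k} (idx : Fin (k * 2)) → ∃[ x ] (idx ≡ openIx {k} x ⊎ idx ≡ closeIx x)
openIx-or-closeIx {suc k} zero = zero , inj₁ refl
openIx-or-closeIx {suc k} (suc zero) = zero , inj₂ refl
openIx-or-closeIx {suc k} (suc (suc idx)) with x , ix ← openIx-or-closeIx {k} idx =
  suc x , Sum.map (cong λ i → suc (suc i)) (cong λ i → suc (suc i)) ix

module RefWords {s k : ℕ} where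

  Sym : Set
  Sym = RefSym s k

  IsVarOp : Sym → Set
  IsVarOp (lsym _) = ⊥
  IsVarOp (opn _) = ⊤
  IsVarOp (cls _) = ⊤

  isVarOp? : ∀ o → Dec (IsVarOp o)
  isVarOp? (lsym _) = no id
  isVarOp? (opn _) = yes tt
  isVarOp? (cls _) = yes tt

  OnVar : Fin k → Sym → Set
  OnVar x (lsym _) = ⊥
  OnVar x (opn y) = y ≡ x
  OnVar x (cls y) = y ≡ x

  onVar? : ∀ x o → Dec (OnVar x o)
  onVar? x (lsym _) = no id
  onVar? x (opn y) = y Fin.≟ x
  onVar? x (cls y) = y Fin.≟ x

  _≟ˢ_ : (a b : Sym) → Dec (a ≡ b)
  lsym a ≟ˢ lsym b = map′ (cong lsym) (λ { refl → refl }) (a Fin.≟ b)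
  opn x ≟ˢ opn y = map′ (cong opn) (λ { refl → refl }) (x Fin.≟ y)
  cls x ≟ˢ cls y = map′ (cong cls) (λ { refl → refl }) (x Fin.≟ y)
  lsym _ ≟ˢ opn _ = no λ ()
  lsym _ ≟ˢ cls _ = no λ ()
  opn _ ≟ˢ lsym _ = no λ ()
  opn _ ≟ˢ cls _ = no λ ()
  cls _ ≟ˢ lsym _ = no λ ()
  cls _ ≟ˢ opn _ = no λ ()

  -- A position of the word structure carries, for each of the 2k tuple entries, a marker telling
  -- whether that entry points at it.
  Markers : Set
  Markers = Fin (k * 2) → Bool

  markerOps : Markers → Fin k → List Sym
  markerOps σ x = (if σ (openIx x) then opn x ∷ [] else []) ++ (if σ (closeIx x) then cls x ∷ [] else [])

  OpsFor : Markers → List Sym → Set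
  OpsFor σ v = All IsVarOp v × (∀ x → filter (onVar? x) v ≡ markerOps σ x)

  opsFor? : ∀ σ v → Dec (OpsFor σ v)
  opsFor? σ v = All.all? isVarOp? v ×-dec Finₚ.all? λ x → ≡-dec _≟ˢ_ (filter (onVar? x) v) (markerOps σ x)

  length-ops : ∀ v → All IsVarOp v → length v ≡ sum (λ x → length (filter (onVar? x) v))
  length-ops [] [] = sym (trans (sum-const k 0) (ℕₚ.*-zeroʳ k))
  length-ops (o ∷ v) (o-op ∷ ops) = trans (cong suc (length-ops v ops)) (sym (sum-count o o-op))
    where
    sum-count : ∀ o → IsVarOp o → sum (λ x → length (filter (onVar? x) (o ∷ v))) ≡ suc (sum λ x → length (filter (onVar? x) v))
    sum-count (opn y) _ = sum-bump y {λ x → length (filter (onVar? x) (opn y ∷ v))}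
      (cong length (filter-accept (onVar? y) {opn y} {v} refl))
      λ x y≢x → cong length (filter-reject (onVar? x) {opn y} {v} (y≢x ∘ sym))
    sum-count (cls y) _ = sum-bump y {λ x → length (filter (onVar? x) (cls y ∷ v))}
      (cong length (filter-accept (onVar? y) {cls y} {v} refl))
      λ x y≢x → cong length (filter-reject (onVar? x) {cls y} {v} (y≢x ∘ sym))

  length-markerOps : ∀ σ x → length (markerOps σ x) ℕ.≤ 2
  length-markerOps σ x with σ (openIx x) | σ (closeIx x)
  ... | true | true = ℕₚ.≤-refl
  ... | true | false = s≤s z≤n
  ... | false | true = s≤s z≤n
  ... | false | false = z≤n

  length-OpsFor : ∀ σ v → OpsFor σ v → length v ℕ.≤ k * 2
  length-OpsFor σ v (ops , v≡) = begin
    length v                                      ≡⟨ length-ops v ops ⟩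
    sum (λ x → length (filter (onVar? x) v))      ≤⟨ sum-mono-≤ (λ x → ℕₚ.≤-trans (ℕₚ.≤-reflexive (cong length (v≡ x))) (length-markerOps σ x)) ⟩
    sum {k} (λ _ → 2)                             ≡⟨ sum-const k 2 ⟩
    k * 2                                         ∎
    where open ℕₚ.≤-Reasoning

  searchOps : ∀ L {P : List Sym → Set} → (∀ v → Dec (P v)) →
              Dec (∃[ v ] All IsVarOp v × length v ℕ.≤ L × P v)
  searchOps L P? with P? []
  ... | yes p = yes ([] , [] , z≤n , p)
  searchOps zero P? | no ¬p = no λ { ([] , _ , _ , p) → ¬p p ; (_ ∷ _ , _ , () , _) }
  searchOps (suc L) P? | no ¬p
    with Finₚ.any? (λ x → searchOps L (P? ∘ (opn x ∷_))) | Finₚ.any? (λ x → searchOps L (P? ∘ (cls x ∷_)))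
  ... | yes (x , v , ops , len , pv) | _ = yes (opn x ∷ v , tt ∷ ops , s≤s len , pv)
  ... | no _ | yes (x , v , ops , len , pv) = yes (cls x ∷ v , tt ∷ ops , s≤s len , pv)
  ... | no ¬opn | no ¬cls = no λ
    { ([] , _ , _ , p) → ¬p p
    ; (lsym _ ∷ _ , () ∷ _ , _ , _)
    ; (opn x ∷ v , _ ∷ ops , s≤s len , pv) → ¬opn (x , v , ops , len , pv)
    ; (cls x ∷ v , _ ∷ ops , s≤s len , pv) → ¬cls (x , v , ops , len , pv) }

  readLetter : Maybe (Fin s) → List Sym
  readLetter (just a) = lsym a ∷ []
  readLetter nothing = []

  -- Opening markers need a symbol position; at $ only closing markers may sit.
  MarkersAllowed : Markers → Maybe (Fin s) → Bool → Set
  MarkersAllowed σ (just a) atEnd = ⊤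
  MarkersAllowed σ nothing false = ∀ i → σ i ≡ false
  MarkersAllowed σ nothing true = ∀ x → σ (openIx {k} x) ≡ false

  markersAllowed? : ∀ σ c atEnd → Dec (MarkersAllowed σ c atEnd)
  markersAllowed? σ (just a) atEnd = yes tt
  markersAllowed? σ nothing false = Finₚ.all? λ i → σ i Boolₚ.≟ false
  markersAllowed? σ nothing true = Finₚ.all? λ x → σ (openIx {k} x) Boolₚ.≟ false

  markerOps-silent : ∀ {σ} → (∀ i → σ i ≡ false) → ∀ x → markerOps σ x ≡ []
  markerOps-silent {σ} silent x rewrite silent (openIx x) | silent (closeIx x) = refl

  OpsFor-silent : ∀ {σ v} → (∀ i → σ i ≡ false) → OpsFor σ v → v ≡ []
  OpsFor-silent {v = []} silent ops = refl
  OpsFor-silent {v = lsym _ ∷ _} silent (() ∷ _ , _)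
  OpsFor-silent {σ} {opn y ∷ v} silent (_ , v≡) with () ← trans (sym (filter-accept (onVar? y) {opn y} {v} refl))
                                                                (trans (v≡ y) (markerOps-silent silent y))
  OpsFor-silent {σ} {cls y ∷ v} silent (_ , v≡) with () ← trans (sym (filter-accept (onVar? y) {cls y} {v} refl))
                                                                (trans (v≡ y) (markerOps-silent silent y))

  markerOps-cong : ∀ {σ σ′} → σ ≗ σ′ → ∀ x → markerOps σ x ≡ markerOps σ′ x
  markerOps-cong σ≗σ′ x rewrite σ≗σ′ (openIx x) | σ≗σ′ (closeIx x) = refl

  MarkersAllowed-cong : ∀ {σ σ′} → σ ≗ σ′ → ∀ c e → MarkersAllowed σ c e → MarkersAllowed σ′ c e
  MarkersAllowed-cong σ≗σ′ (just _) e ok = tt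
  MarkersAllowed-cong σ≗σ′ nothing false ok i = trans (sym (σ≗σ′ i)) (ok i)
  MarkersAllowed-cong σ≗σ′ nothing true ok x = trans (sym (σ≗σ′ (openIx x))) (ok x)

nLetters-++ : ∀ {s k} (l₁ l₂ : List (RefSym s k)) → nLetters (l₁ ++ l₂) ≡ nLetters l₁ + nLetters l₂
nLetters-++ [] l₂ = refl
nLetters-++ (lsym _ ∷ l₁) l₂ = cong suc (nLetters-++ l₁ l₂)
nLetters-++ (opn _ ∷ l₁) l₂ = nLetters-++ l₁ l₂
nLetters-++ (cls _ ∷ l₁) l₂ = nLetters-++ l₁ l₂

clr-++ : ∀ {s k} (l₁ l₂ : List (RefSym s k)) → clr (l₁ ++ l₂) ≡ clr l₁ ++ clr l₂
clr-++ [] l₂ = refl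
clr-++ (lsym a ∷ l₁) l₂ = cong (a ∷_) (clr-++ l₁ l₂)
clr-++ (opn _ ∷ l₁) l₂ = clr-++ l₁ l₂
clr-++ (cls _ ∷ l₁) l₂ = clr-++ l₁ l₂

VarSpan-≤ : ∀ {s k} {r : List (RefSym s k)} {x i j} → VarSpan r x (i , j) → i ℕ.≤ j
VarSpan-≤ (r₁ , r₂ , _ , _ , _ , _ , refl , refl) = s≤s (ℕₚ.m≤m+n _ _)

module Annotation {s k : ℕ} where
  open RefWords {s} {k}

  -- Pairs every variable operation of a ref-word with c plus the number of letters before it, so
  -- that VarSpan can be read off the operations on x alone.
  annotate : List Sym → ℕ → List (Sym × ℕ)
  annotate [] c = []
  annotate (lsym _ ∷ r) c = annotate r (suc c)
  annotate (opn x ∷ r) c = (opn x , c) ∷ annotate r c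
  annotate (cls x ∷ r) c = (cls x , c) ∷ annotate r c

  opsOn : Fin k → List (Sym × ℕ) → List (Sym × ℕ)
  opsOn x = filter (onVar? x ∘ proj₁)

  at : ℕ → List Sym → List (Sym × ℕ)
  at c = map (_, c)

  annotate-++ : ∀ l₁ l₂ c → annotate (l₁ ++ l₂) c ≡ annotate l₁ c ++ annotate l₂ (c + nLetters l₁)
  annotate-++ [] l₂ c = cong (annotate l₂) (sym (ℕₚ.+-identityʳ c))
  annotate-++ (lsym _ ∷ l₁) l₂ c = trans (annotate-++ l₁ l₂ (suc c)) (cong (λ c′ → annotate l₁ (suc c) ++ annotate l₂ c′) (sym (ℕₚ.+-suc c _)))
  annotate-++ (opn x ∷ l₁) l₂ c = cong (_ ∷_) (annotate-++ l₁ l₂ c)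
  annotate-++ (cls x ∷ l₁) l₂ c = cong (_ ∷_) (annotate-++ l₁ l₂ c)

  annotate-ops : ∀ {v} c → All IsVarOp v → annotate v c ≡ at c v
  annotate-ops c [] = refl
  annotate-ops {opn x ∷ v} c (_ ∷ ops) = cong (_ ∷_) (annotate-ops c ops)
  annotate-ops {cls x ∷ v} c (_ ∷ ops) = cong (_ ∷_) (annotate-ops c ops)

  nLetters-ops : ∀ {v} → All IsVarOp v → nLetters v ≡ 0
  nLetters-ops [] = refl
  nLetters-ops {opn x ∷ v} (_ ∷ ops) = nLetters-ops ops
  nLetters-ops {cls x ∷ v} (_ ∷ ops) = nLetters-ops ops

  clr-ops : ∀ {v} → All IsVarOp v → clr v ≡ []
  clr-ops [] = refl
  clr-ops {opn x ∷ v} (_ ∷ ops) = clr-ops ops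
  clr-ops {cls x ∷ v} (_ ∷ ops) = clr-ops ops

  opsOn-at : ∀ x c v → opsOn x (at c v) ≡ at c (filter (onVar? x) v)
  opsOn-at x c [] = refl
  opsOn-at x c (o ∷ v) with does (onVar? x o)
  ... | true = cong ((o , c) ∷_) (opsOn-at x c v)
  ... | false = opsOn-at x c v

  opsOn-annotate-ops : ∀ x {v} c → All IsVarOp v → opsOn x (annotate v c) ≡ at c (filter (onVar? x) v)
  opsOn-annotate-ops x {v} c ops = trans (cong (opsOn x) (annotate-ops c ops)) (opsOn-at x c v)

  opsOn-absent : ∀ x l c → opn x ∉ l → cls x ∉ l → opsOn x (annotate l c) ≡ []
  opsOn-absent x [] c _ _ = refl
  opsOn-absent x (lsym _ ∷ l) c opn∉ cls∉ = opsOn-absent x l (suc c) (opn∉ ∘ there) (cls∉ ∘ there)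
  opsOn-absent x (opn y ∷ l) c opn∉ cls∉ with y Fin.≟ x
  ... | yes refl = contradiction (here refl) opn∉
  ... | no _ = opsOn-absent x l c (opn∉ ∘ there) (cls∉ ∘ there)
  opsOn-absent x (cls y ∷ l) c opn∉ cls∉ with y Fin.≟ x
  ... | yes refl = contradiction (here refl) cls∉
  ... | no _ = opsOn-absent x l c (opn∉ ∘ there) (cls∉ ∘ there)

  opsOn-absent⁻ : ∀ x l c → opsOn x (annotate l c) ≡ [] → opn x ∉ l × cls x ∉ l
  opsOn-absent⁻ x [] c _ = (λ ()) , (λ ())
  opsOn-absent⁻ x (lsym _ ∷ l) c none with opn∉ , cls∉ ← opsOn-absent⁻ x l (suc c) none =
    (λ { (there m) → opn∉ m }) , (λ { (there m) → cls∉ m })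
  opsOn-absent⁻ x (opn y ∷ l) c none with y Fin.≟ x
  ... | yes refl with () ← none
  ... | no y≢x with opn∉ , cls∉ ← opsOn-absent⁻ x l c none =
    (λ { (here refl) → y≢x refl ; (there m) → opn∉ m }) , (λ { (there m) → cls∉ m })
  opsOn-absent⁻ x (cls y ∷ l) c none with y Fin.≟ x
  ... | yes refl with () ← none
  ... | no y≢x with opn∉ , cls∉ ← opsOn-absent⁻ x l c none =
    (λ { (there m) → opn∉ m }) , (λ { (here refl) → y≢x refl ; (there m) → cls∉ m })

  annotate-op : ∀ {o} l c → IsVarOp o → annotate (o ∷ l) c ≡ (o , c) ∷ annotate l c
  annotate-op {opn _} l c _ = refl
  annotate-op {cls _} l c _ = refl

  nLetters-op : ∀ {o} l → IsVarOp o → nLetters {s} {k} (o ∷ l) ≡ nLetters l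
  nLetters-op {opn _} l _ = refl
  nLetters-op {cls _} l _ = refl

  FirstOpOn : Fin k → List Sym → ℕ → Sym → ℕ → List (Sym × ℕ) → Set
  FirstOpOn x l c o i rest =
    ∃[ l₁ ] ∃[ l₂ ] l ≡ l₁ ++ o ∷ l₂ × opsOn x (annotate l₁ c) ≡ [] × i ≡ c + nLetters l₁
                  × opsOn x (annotate l₂ (c + nLetters l₁)) ≡ rest

  opsOn-split : ∀ x l c {o i rest} → opsOn x (annotate l c) ≡ (o , i) ∷ rest → FirstOpOn x l c o i rest
  opsOn-split-op : ∀ x {o′} → IsVarOp o′ → ∀ l c {o i rest} →
                   opsOn x ((o′ , c) ∷ annotate l c) ≡ (o , i) ∷ rest → FirstOpOn x (o′ ∷ l) c o i rest

  opsOn-split x (lsym a ∷ l) c {rest = rest} first with l₁ , l₂ , l≡ , none , i≡ , rest≡ ← opsOn-split x l (suc c) first =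
    lsym a ∷ l₁ , l₂ , cong (lsym a ∷_) l≡ , none , trans i≡ (sym (ℕₚ.+-suc c _)) ,
    subst (λ c′ → opsOn x (annotate l₂ c′) ≡ rest) (sym (ℕₚ.+-suc c _)) rest≡
  opsOn-split x (opn y ∷ l) c first = opsOn-split-op x tt l c first
  opsOn-split x (cls y ∷ l) c first = opsOn-split-op x tt l c first

  opsOn-split-op x {o′} op l c {rest = rest} first with does (onVar? x o′) in on-x
  ... | true with refl ← first =
    [] , l , refl , refl , sym (ℕₚ.+-identityʳ c) , cong (λ c′ → opsOn x (annotate l c′)) (ℕₚ.+-identityʳ c)
  ... | false with l₁ , l₂ , l≡ , none , i≡ , rest≡ ← opsOn-split x l c first =
    o′ ∷ l₁ , l₂ , cong (o′ ∷_) l≡ ,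
    trans (cong (opsOn x) (annotate-op l₁ c op)) (trans (filter-reject (onVar? x ∘ proj₁) ¬on-x) none) ,
    trans i≡ (cong (c +_) (sym (nLetters-op l₁ op))) ,
    subst (λ m → opsOn x (annotate l₂ (c + m)) ≡ rest) (sym (nLetters-op l₁ op)) rest≡
    where
    ¬on-x : ¬ OnVar x o′
    ¬on-x on = contradiction (trans (sym (dec-true (onVar? x o′) on)) on-x) λ ()

  private
    ∉-++⁻ : ∀ {o : Sym} (r₁ r₂ r₃ : List Sym) → o ∉ r₁ ++ r₂ ++ r₃ → o ∉ r₁ × o ∉ r₂ × o ∉ r₃
    ∉-++⁻ r₁ r₂ r₃ ∉all = (λ m → ∉all (from ++-∈⇔ (inj₁ m))) ,
                          (λ m → ∉all (from (++-∈⇔ {xs = r₁}) (inj₂ (from ++-∈⇔ (inj₁ m))))) ,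
                          (λ m → ∉all (from (++-∈⇔ {xs = r₁}) (inj₂ (from (++-∈⇔ {xs = r₂}) (inj₂ m)))))

    ∉-++⁺ : ∀ {o : Sym} (r₁ r₂ r₃ : List Sym) → o ∉ r₁ → o ∉ r₂ → o ∉ r₃ → o ∉ r₁ ++ r₂ ++ r₃
    ∉-++⁺ r₁ r₂ r₃ ∉₁ ∉₂ ∉₃ m = [ ∉₁ , [ ∉₂ , ∉₃ ]′ ∘ to (++-∈⇔ {xs = r₂}) ]′ (to (++-∈⇔ {xs = r₁}) m)

  VarSpan⇒opsOn : ∀ r x {i j} → VarSpan r x (i , j) → opsOn x (annotate r 1) ≡ (opn x , i) ∷ (cls x , j) ∷ []
  VarSpan⇒opsOn _ x (r₁ , r₂ , r₃ , refl , opn∉ , cls∉ , refl , refl)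
    with opn∉₁ , opn∉₂ , opn∉₃ ← ∉-++⁻ r₁ r₂ r₃ opn∉
       | cls∉₁ , cls∉₂ , cls∉₃ ← ∉-++⁻ r₁ r₂ r₃ cls∉ = begin
    opsOn x (annotate (r₁ ++ opn x ∷ r₂ ++ cls x ∷ r₃) 1)
      ≡⟨ cong (opsOn x) (annotate-++ r₁ _ 1) ⟩
    opsOn x (annotate r₁ 1 ++ (opn x , i) ∷ annotate (r₂ ++ cls x ∷ r₃) i)
      ≡⟨ filter-++ (onVar? x ∘ proj₁) (annotate r₁ 1) _ ⟩
    opsOn x (annotate r₁ 1) ++ opsOn x ((opn x , i) ∷ annotate (r₂ ++ cls x ∷ r₃) i)
      ≡⟨ cong₂ _++_ (opsOn-absent x r₁ 1 opn∉₁ cls∉₁) (filter-accept (onVar? x ∘ proj₁) refl) ⟩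
    (opn x , i) ∷ opsOn x (annotate (r₂ ++ cls x ∷ r₃) i)
      ≡⟨ cong (λ l → (opn x , i) ∷ opsOn x l) (annotate-++ r₂ _ i) ⟩
    (opn x , i) ∷ opsOn x (annotate r₂ i ++ (cls x , j) ∷ annotate r₃ j)
      ≡⟨ cong ((opn x , i) ∷_) (filter-++ (onVar? x ∘ proj₁) (annotate r₂ i) _) ⟩
    (opn x , i) ∷ opsOn x (annotate r₂ i) ++ opsOn x ((cls x , j) ∷ annotate r₃ j)
      ≡⟨ cong ((opn x , i) ∷_) (cong₂ _++_ (opsOn-absent x r₂ i opn∉₂ cls∉₂) (filter-accept (onVar? x ∘ proj₁) refl)) ⟩
    (opn x , i) ∷ (cls x , j) ∷ opsOn x (annotate r₃ j)
      ≡⟨ cong (λ l → (opn x , i) ∷ (cls x , j) ∷ l) (opsOn-absent x r₃ j opn∉₃ cls∉₃) ⟩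
    (opn x , i) ∷ (cls x , j) ∷ []
      ∎
    where
    open ≡-Reasoning
    i = suc (nLetters r₁)
    j = suc (nLetters r₁ + nLetters r₂)

  opsOn⇒VarSpan : ∀ r x {i j} → opsOn x (annotate r 1) ≡ (opn x , i) ∷ (cls x , j) ∷ [] → VarSpan r x (i , j)
  opsOn⇒VarSpan r x ops
    with r₁ , l , r≡ , none₁ , i≡ , rest ← opsOn-split x r 1 ops
    with r₂ , r₃ , l≡ , none₂ , j≡ , none₃ ← opsOn-split x l (1 + nLetters r₁) rest
    with opn∉₁ , cls∉₁ ← opsOn-absent⁻ x r₁ _ none₁
       | opn∉₂ , cls∉₂ ← opsOn-absent⁻ x r₂ _ none₂
       | opn∉₃ , cls∉₃ ← opsOn-absent⁻ x r₃ _ none₃ =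
    r₁ , r₂ , r₃ , trans r≡ (cong (λ l → r₁ ++ opn x ∷ l) l≡) ,
    ∉-++⁺ r₁ r₂ r₃ opn∉₁ opn∉₂ opn∉₃ , ∉-++⁺ r₁ r₂ r₃ cls∉₁ cls∉₂ cls∉₃ , i≡ , j≡

module Automaton {s k : ℕ} (A : VSA s k) where
  open VSA A
  open RefWords {s} {k}

  State : Set
  State = Fin nStates

  Path-++⁺ : ∀ {p m q l₁ l₂} → Path A p l₁ m → Path A m l₂ q → Path A p (l₁ ++ l₂) q
  Path-++⁺ here π = π
  Path-++⁺ (epsS e π) π′ = epsS e (Path-++⁺ π π′)
  Path-++⁺ (symS e π) π′ = symS e (Path-++⁺ π π′)

  Path-++⁻ : ∀ {p q} l₁ {l₂} → Path A p (l₁ ++ l₂) q → ∃[ m ] Path A p l₁ m × Path A m l₂ q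
  Path-++⁻ [] π = _ , here , π
  Path-++⁻ (c ∷ l₁) (epsS e π) with m , π₁ , π₂ ← Path-++⁻ (c ∷ l₁) π = m , epsS e π₁ , π₂
  Path-++⁻ (c ∷ l₁) (symS e π) with m , π₁ , π₂ ← Path-++⁻ l₁ π = m , symS e π₁ , π₂

  Path-∷⁻ : ∀ {p q c l} → Path A p (c ∷ l) q →
            ∃[ p₁ ] ∃[ p₂ ] Path A p [] p₁ × T (δ p₁ (just c) p₂) × Path A p₂ l q
  Path-∷⁻ (epsS e π) with p₁ , p₂ , π₁ , e′ , π₂ ← Path-∷⁻ π = p₁ , p₂ , epsS e π₁ , e′ , π₂
  Path-∷⁻ (symS e π) = _ , _ , here , e , π

  _⟶ε_ : State → State → Set
  p ⟶ε q = T (δ p nothing q)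

  Star⇒Path : ∀ {p q} → Star _⟶ε_ p q → Path A p [] q
  Star⇒Path ε = here
  Star⇒Path (e ◅ steps) = epsS e (Star⇒Path steps)

  Path⇒Star : ∀ {p q} → Path A p [] q → Star _⟶ε_ p q
  Path⇒Star here = ε
  Path⇒Star (epsS e π) = e ◅ Path⇒Star π

  path? : ∀ p l q → Dec (Path A p l q)
  path? p [] q = map′ Star⇒Path Path⇒Star (DecidableStar.star? _⟶ε_ (λ a b → T? (δ a nothing b)) p q)
  path? p (c ∷ l) q =
    map′ (λ (p₁ , p₂ , π₁ , e , π₂) → Path-++⁺ π₁ (symS e π₂)) Path-∷⁻
         (Finₚ.any? λ p₁ → Finₚ.any? λ p₂ → path? p [] p₁ ×-dec T? (δ p₁ (just c) p₂) ×-dec path? p₂ l q)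

  BlockStep : Markers → Maybe (Fin s) → Bool → State → State → Set
  BlockStep σ c atEnd p q = MarkersAllowed σ c atEnd × ∃[ v ] OpsFor σ v × Path A p (v ++ readLetter c) q

  -- OpsFor σ v forces length v ≤ 2k, so a bounded search decides BlockStep.
  blockStep? : ∀ σ c atEnd p q → Dec (BlockStep σ c atEnd p q)
  blockStep? σ c atEnd p q =
    markersAllowed? σ c atEnd ×-dec
    map′ (λ (v , _ , _ , ops , π) → v , ops , π) (λ (v , ops , π) → v , proj₁ ops , length-OpsFor σ v ops , ops , π)
         (searchOps (k * 2) λ v → opsFor? σ v ×-dec path? p (v ++ readLetter c) q)

  BlockStep-silent : ∀ {σ p q} → BlockStep σ nothing false p q ⇔ ((∀ i → σ i ≡ false) × Path A p [] q)
  BlockStep-silent {σ} {p} {q} = mk⇔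
    (λ (silent , v , ops , π) → silent , subst (λ l → Path A p (l ++ []) q) (OpsFor-silent silent ops) π)
    (λ (silent , π) → silent , [] , ([] , λ x → sym (markerOps-silent silent x)) , π)

  BlockStep-cong : ∀ {σ σ′ c e p q} → σ ≗ σ′ → BlockStep σ c e p q → BlockStep σ′ c e p q
  BlockStep-cong {c = c} {e} σ≗σ′ (ok , v , (ops , v≡) , π) =
    MarkersAllowed-cong σ≗σ′ c e ok , v , (ops , λ x → trans (v≡ x) (markerOps-cong σ≗σ′ x)) , π

-- Word structures

atℕ : ∀ {m} {X : Set} → (Fin m → Maybe X) → ℕ → Maybe X
atℕ {zero} f i = nothing
atℕ {suc m} f zero = f zero
atℕ {suc m} f (suc i) = atℕ (f ∘ suc) i

atℕ-toℕ : ∀ {m} {X : Set} (f : Fin m → Maybe X) d → atℕ f (toℕ d) ≡ f d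
atℕ-toℕ f zero = refl
atℕ-toℕ f (suc d) = atℕ-toℕ (f ∘ suc) d

atℕ-cong : ∀ {m} {X : Set} {f g : Fin m → Maybe X} i → (∀ d → toℕ d ≡ i → f d ≡ g d) → atℕ f i ≡ atℕ g i
atℕ-cong {zero} i f≡g = refl
atℕ-cong {suc m} zero f≡g = f≡g zero refl
atℕ-cong {suc m} {f = f} {g} (suc i) f≡g = atℕ-cong i λ d e → f≡g (suc d) (cong suc e)

atℕ-≥ : ∀ {m} {X : Set} (f : Fin m → Maybe X) i → m ℕ.≤ i → atℕ f i ≡ nothing
atℕ-≥ {zero} f i m≤i = refl
atℕ-≥ {suc m} f (suc i) (s≤s m≤i) = atℕ-≥ (f ∘ suc) i m≤i

atℕ-nothing : ∀ {m} {X : Set} i → atℕ {m} {X} (λ _ → nothing) i ≡ nothing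
atℕ-nothing {zero} i = refl
atℕ-nothing {suc m} zero = refl
atℕ-nothing {suc m} (suc i) = atℕ-nothing {m} i

lettersFrom : ∀ {X : Set} → (ℕ → Maybe X) → ℕ → ℕ → List X
lettersFrom g a zero = []
lettersFrom g a (suc len) = fromMaybe (g a) ++ lettersFrom g (suc a) len

count : ∀ {X : Set} → (ℕ → Maybe X) → ℕ → ℕ → ℕ
count g a len = length (lettersFrom g a len)

lettersFrom-++ : ∀ {X : Set} (g : ℕ → Maybe X) a l₁ l₂ →
                 lettersFrom g a (l₁ + l₂) ≡ lettersFrom g a l₁ ++ lettersFrom g (a + l₁) l₂
lettersFrom-++ g a zero l₂ rewrite ℕₚ.+-identityʳ a = refl
lettersFrom-++ g a (suc l₁) l₂ rewrite ℕₚ.+-suc a l₁ =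
  trans (cong (fromMaybe (g a) ++_) (lettersFrom-++ g (suc a) l₁ l₂)) (sym (++-assoc (fromMaybe (g a)) _ _))

count-+ : ∀ {X : Set} (g : ℕ → Maybe X) a l₁ l₂ → count g a (l₁ + l₂) ≡ count g a l₁ + count g (a + l₁) l₂
count-+ g a l₁ l₂ = trans (cong length (lettersFrom-++ g a l₁ l₂)) (length-++ (lettersFrom g a l₁))

lettersFrom-cong : ∀ {X : Set} {g g′ : ℕ → Maybe X} a len → (∀ i → a ℕ.≤ i → i ℕ.< a + len → g i ≡ g′ i) →
                   lettersFrom g a len ≡ lettersFrom g′ a len
lettersFrom-cong a zero same = refl
lettersFrom-cong a (suc len) same =
  cong₂ _++_ (cong fromMaybe (same a ℕₚ.≤-refl (ℕₚ.m<m+n a (s≤s z≤n))))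
             (lettersFrom-cong (suc a) len λ i a<i i< → same i (ℕₚ.<⇒≤ a<i) (subst (i ℕ.<_) (sym (ℕₚ.+-suc a len)) i<))

lettersFrom-nothing : ∀ {X : Set} {g : ℕ → Maybe X} a len → (∀ i → a ℕ.≤ i → g i ≡ nothing) → lettersFrom g a len ≡ []
lettersFrom-nothing a zero none = refl
lettersFrom-nothing a (suc len) none rewrite none a ℕₚ.≤-refl = lettersFrom-nothing (suc a) len λ i a<i → none i (ℕₚ.<⇒≤ a<i)

count-suc : ∀ {X : Set} (g : ℕ → Maybe X) m → count g 0 (suc m) ≡ count g 0 m + length (fromMaybe (g m))
count-suc g m = trans (cong (count g 0) (sym (ℕₚ.+-comm m 1))) (trans (count-+ g 0 m 1) (cong (count g 0 m +_) (trans (length-++ (fromMaybe (g m))) (ℕₚ.+-identityʳ _))))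

count-mono : ∀ {X : Set} (g : ℕ → Maybe X) {i j} → i ℕ.≤ j → count g 0 i ℕ.≤ count g 0 j
count-mono g {i} {j} i≤j = subst (count g 0 i ℕ.≤_) (trans (sym (count-+ g 0 i (j ∸ i))) (cong (count g 0) (ℕₚ.m+[n∸m]≡n i≤j)))
                                  (ℕₚ.m≤m+n _ _)

lettersFrom-suc : ∀ {m} {X : Set} (f : Fin (suc m) → Maybe X) a len → lettersFrom (atℕ f) (suc a) len ≡ lettersFrom (atℕ (f ∘ suc)) a len
lettersFrom-suc f a zero = refl
lettersFrom-suc f a (suc len) = cong (fromMaybe (atℕ f (suc a)) ++_) (lettersFrom-suc f (suc a) len)

catMaybes-∷ : ∀ {X : Set} (x : Maybe X) xs → catMaybes (x ∷ xs) ≡ fromMaybe x ++ catMaybes xs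
catMaybes-∷ (just x) xs = refl
catMaybes-∷ nothing xs = refl

catMaybes-tabulate : ∀ {m} {X : Set} (f : Fin m → Maybe X) → catMaybes (tabulateˡ f) ≡ lettersFrom (atℕ f) 0 m
catMaybes-tabulate {zero} f = refl
catMaybes-tabulate {suc m} f = trans (catMaybes-∷ (f zero) (tabulateˡ (f ∘ suc)))
  (cong (fromMaybe (f zero) ++_) (trans (catMaybes-tabulate (f ∘ suc)) (sym (lettersFrom-suc f 0 m))))

mapMaybe-allFin : ∀ {m} {X : Set} (f : Fin m → Maybe X) → mapMaybe f (allFin m) ≡ lettersFrom (atℕ f) 0 m
mapMaybe-allFin f = trans (cong catMaybes (map-tabulate id f)) (catMaybes-tabulate f)

module Positions {s n : ℕ} (w : WordS s n) where

  W : ℕ → Maybe (Fin s)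
  W = atℕ w

  word-letters : word w ≡ lettersFrom W 0 (suc n)
  word-letters = mapMaybe-allFin w

  pos-count : ∀ d → pos w d ≡ count W 0 (suc (toℕ d))
  pos-count d = begin
    pos w d                                                  ≡⟨ cong length (mapMaybe-allFin upTo-d) ⟩
    count (atℕ upTo-d) 0 (suc n)                             ≡⟨ cong (count (atℕ upTo-d) 0) (cong suc (ℕₚ.m+[n∸m]≡n D≤n)) ⟨
    count (atℕ upTo-d) 0 (suc D + (n ∸ D))                   ≡⟨ count-+ (atℕ upTo-d) 0 (suc D) (n ∸ D) ⟩
    count (atℕ upTo-d) 0 (suc D) + count (atℕ upTo-d) (suc D) (n ∸ D)
                                                             ≡⟨ cong₂ _+_ (cong length (lettersFrom-cong 0 (suc D) below)) (cong length (lettersFrom-nothing (suc D) (n ∸ D) above)) ⟩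
    count W 0 (suc D) + 0                                    ≡⟨ ℕₚ.+-identityʳ _ ⟩
    count W 0 (suc D)                                        ∎
    where
    open ≡-Reasoning
    D = toℕ d
    D≤n : D ℕ.≤ n
    D≤n = Finₚ.toℕ≤pred[n] d
    upTo-d : Dom n → Maybe (Fin s)
    upTo-d i = if does (i Finₚ.≤? d) then w i else nothing
    below : ∀ i → 0 ℕ.≤ i → i ℕ.< suc D → atℕ upTo-d i ≡ W i
    below i _ i≤D = atℕ-cong i λ d′ e → cong (if_then w d′ else nothing) (dec-true (d′ Finₚ.≤? d) (ℕₚ.≤-pred (subst (ℕ._< suc D) (sym e) i≤D)))
    above : ∀ i → suc D ℕ.≤ i → atℕ upTo-d i ≡ nothing
    above i D<i = trans (atℕ-cong i λ d′ e → cong (if_then w d′ else nothing) (dec-false (d′ Finₚ.≤? d) λ d′≤d → ℕₚ.<⇒≱ D<i (subst (ℕ._≤ D) e d′≤d)))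
                        (atℕ-nothing {suc n} i)

  pos-symbol : ∀ d → IsSymbol w d → pos w d ≡ suc (count W 0 (toℕ d))
  pos-symbol d d-sym with w d in wd
  ... | nothing = contradiction refl d-sym
  ... | just a = begin
    pos w d                                                  ≡⟨ pos-count d ⟩
    count W 0 (suc (toℕ d))                                  ≡⟨ count-suc W (toℕ d) ⟩
    count W 0 (toℕ d) + length (fromMaybe (W (toℕ d)))       ≡⟨ cong (λ c → count W 0 (toℕ d) + length (fromMaybe c)) (trans (atℕ-toℕ w d) wd) ⟩
    count W 0 (toℕ d) + 1                                    ≡⟨ ℕₚ.+-comm _ 1 ⟩
    suc (count W 0 (toℕ d))                                  ∎
    where open ≡-Reasoning

  module _ (w$ : w (dollar n) ≡ nothing) where

    W-dollar : W n ≡ nothing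
    W-dollar = trans (cong W (sym (Finₚ.toℕ-fromℕ n))) (trans (atℕ-toℕ w (dollar n)) w$)

    length-word : length (word w) ≡ count W 0 n
    length-word = begin
      length (word w)                              ≡⟨ cong length word-letters ⟩
      count W 0 (suc n)                            ≡⟨ count-suc W n ⟩
      count W 0 n + length (fromMaybe (W n))       ≡⟨ cong (λ c → count W 0 n + length (fromMaybe c)) W-dollar ⟩
      count W 0 n + 0                              ≡⟨ ℕₚ.+-identityʳ _ ⟩
      count W 0 n                                  ∎
      where open ≡-Reasoning

newLetter : ∀ {s} → Op s → Maybe (Fin s)
newLetter (ins a) = just a
newLetter reset = nothing

-- Runs of the automaton along a word structure

module Runs {s k : ℕ} (A : VSA s k) (n : ℕ) where
  open VSA A
  open RefWords {s} {k}
  open Automaton A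

  Tuple : Set
  Tuple = Fin (k * 2) → Dom n

  markersAt : Tuple → ℕ → Markers
  markersAt t i idx = does (toℕ (t idx) ℕ.≟ i)

  isEnd : ℕ → Bool
  isEnd i = does (i ℕ.≟ n)

  BlockAt : WordS s n → Tuple → ℕ → State → State → Set
  BlockAt w t i = BlockStep (markersAt t i) (atℕ w i) (isEnd i)

  -- Positions are 0-based here: the domain element d sits at position toℕ d.
  Run : WordS s n → Tuple → State → State → ℕ → ℕ → Set
  Run w t p q a zero = Path A p [] q
  Run w t p q a (suc len) = ∃[ m ] BlockAt w t a p m × Run w t m q (suc a) len

  Segment : WordS s n → Tuple → State → State → ℕ → ℕ → Set
  Segment w t p q a b = Run w t p q a (b ∸ a)

  BlockStep-ε-around : ∀ {σ c e p m m′ q} → Path A p [] m → BlockStep σ c e m m′ → Path A m′ [] q → BlockStep σ c e p q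
  BlockStep-ε-around {c = c} {p = p} {q = q} π (ok , v , ops , π′) π″ =
    ok , v , ops , subst (λ l → Path A p l q) (++-identityʳ (v ++ readLetter c)) (Path-++⁺ π (Path-++⁺ π′ π″))

  Run-++ : ∀ {w t p q} a l₁ l₂ → Run w t p q a (l₁ + l₂) ⇔ (∃[ m ] Run w t p m a l₁ × Run w t m q (a + l₁) l₂)
  Run-++ a zero l₂ rewrite ℕₚ.+-identityʳ a = mk⇔ (λ r → _ , here , r) (λ { (m , π , r) → absorb l₂ π r })
    where
    absorb : ∀ {w t p m q b} l → Path A p [] m → Run w t m q b l → Run w t p q b l
    absorb zero π π′ = Path-++⁺ π π′
    absorb (suc l) π (m′ , block , r) = m′ , BlockStep-ε-around π block here , r
  Run-++ a (suc l₁) l₂ rewrite ℕₚ.+-suc a l₁ = mk⇔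
    (λ (m , block , r) → let (m′ , r₁ , r₂) = to (Run-++ (suc a) l₁ l₂) r in m′ , (m , block , r₁) , r₂)
    (λ (m′ , (m , block , r₁) , r₂) → m , block , from (Run-++ (suc a) l₁ l₂) (m′ , r₁ , r₂))

  Segment-here : ∀ {w t p q a} → Segment w t p q a a ⇔ Path A p [] q
  Segment-here {a = a} rewrite ℕₚ.n∸n≡0 a = mk⇔ id id

  Segment-split : ∀ {w t p q a u b} → a ℕ.≤ u → u ℕ.< b →
    Segment w t p q a b ⇔ (∃[ m ] ∃[ m′ ] Segment w t p m a u × BlockAt w t u m m′ × Segment w t m′ q (suc u) b)
  Segment-split {w} {t} {p} {q} {a} {u} {b} a≤u u<b
    rewrite ∸-split a≤u (ℕₚ.<⇒≤ u<b) | ℕₚ.+-∸-assoc 1 u<b = mk⇔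
      (λ r → let (m , r₁ , m′ , block , r₂) = subst Split a+[u∸a]≡u (to (Run-++ a (u ∸ a) _) r) in m , m′ , r₁ , block , r₂)
      (λ (m , m′ , r₁ , block , r₂) → from (Run-++ a (u ∸ a) _) (subst Split (sym a+[u∸a]≡u) (m , r₁ , m′ , block , r₂)))
    where
    Split : ℕ → Set
    Split c = ∃[ m ] Run w t p m a (u ∸ a) × Run w t m q c (suc (b ∸ suc u))
    a+[u∸a]≡u : a + (u ∸ a) ≡ u
    a+[u∸a]≡u = ℕₚ.m+[n∸m]≡n a≤u

  Segment-cong : ∀ {w w′ t p q a b} → (∀ i → a ℕ.≤ i → i ℕ.< b → atℕ w′ i ≡ atℕ w i) →
                 Segment w′ t p q a b ⇔ Segment w t p q a b
  Segment-cong {w} {w′} {t} {p} {q} {a} {b} same = go p a (b ∸ a) λ i a≤i i<a+l → same i a≤i (to (<-+∸⇔< a≤i) i<a+l)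
    where
    go : ∀ p a l → (∀ i → a ℕ.≤ i → i ℕ.< a + l → atℕ w′ i ≡ atℕ w i) → Run w′ t p q a l ⇔ Run w t p q a l
    go p a zero same = mk⇔ id id
    go p a (suc l) same = mk⇔
      (λ (m , block , r) → m , subst (λ c → BlockStep _ c _ p m) letter block , to (rest m) r)
      (λ (m , block , r) → m , subst (λ c → BlockStep _ c _ p m) (sym letter) block , from (rest m) r)
      where
      letter = same a ℕₚ.≤-refl (ℕₚ.m<m+n a (s≤s z≤n))
      rest : ∀ m → Run w′ t m q (suc a) l ⇔ Run w t m q (suc a) l
      rest m = go m (suc a) l λ i a<i i< → same i (ℕₚ.<⇒≤ a<i) (subst (i ℕ.<_) (sym (ℕₚ.+-suc a l)) i<)

  applyW-at : ∀ (w : WordS s n) op u → applyW w op u u ≡ newLetter op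
  applyW-at w (ins a) u rewrite dec-true (u Fin.≟ u) refl = refl
  applyW-at w reset u rewrite dec-true (u Fin.≟ u) refl = refl

  applyW-other : ∀ (w : WordS s n) op {u d} → d ≢ u → applyW w op u d ≡ w d
  applyW-other w (ins a) {u} {d} d≢u rewrite dec-false (d Fin.≟ u) d≢u = refl
  applyW-other w reset {u} {d} d≢u rewrite dec-false (d Fin.≟ u) d≢u = refl

  atℕ-applyW-at : ∀ (w : WordS s n) op u → atℕ (applyW w op u) (toℕ u) ≡ newLetter op
  atℕ-applyW-at w op u = trans (atℕ-toℕ _ u) (applyW-at w op u)

  atℕ-applyW-other : ∀ (w : WordS s n) op u {i} → i ≢ toℕ u → atℕ (applyW w op u) i ≡ atℕ w i
  atℕ-applyW-other w op u {i} i≢u = atℕ-cong i λ d e → applyW-other w op λ d≡u → i≢u (trans (sym e) (cong toℕ d≡u))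

  module _ (w : WordS s n) (op : Op s) (u : Dom n) (t : Tuple) where

    private
      w′ = applyW w op u
      U = toℕ u

    Segment-applyW-outside : ∀ {p q a b} → ¬ (a ℕ.≤ U × U ℕ.< b) → Segment w′ t p q a b ⇔ Segment w t p q a b
    Segment-applyW-outside {p} {q} {a} {b} out =
      Segment-cong {w} {w′} {t} {p} {q} {a} {b} λ i a≤i i<b → atℕ-applyW-other w op u {i} λ { refl → out (a≤i , i<b) }

    Segment-applyW-split : ∀ {p q a b} → a ℕ.≤ U → U ℕ.< b →
      Segment w′ t p q a b ⇔ (∃[ m ] ∃[ m′ ] Segment w t p m a U × BlockAt w′ t U m m′ × Segment w t m′ q (suc U) b)
    Segment-applyW-split {p} {q} {a} {b} a≤U U<b = mk⇔
      (λ r → let (m , m′ , r₁ , block , r₂) = to split r in m , m′ , to (left m) r₁ , block , to (right m′) r₂)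
      (λ (m , m′ , r₁ , block , r₂) → from split (m , m′ , from (left m) r₁ , block , from (right m′) r₂))
      where
      split = Segment-split {w′} {t} {p} {q} {a} {U} {b} a≤U U<b
      left : ∀ m → Segment w′ t p m a U ⇔ Segment w t p m a U
      left m = Segment-applyW-outside {p} {m} {a} {U} λ (_ , U<U) → ℕₚ.<-irrefl refl U<U
      right : ∀ m′ → Segment w′ t m′ q (suc U) b ⇔ Segment w t m′ q (suc U) b
      right m′ = Segment-applyW-outside {m′} {q} {suc U} {b} λ (U<U , _) → ℕₚ.<-irrefl refl U<U

  Ordered : Tuple → Set
  Ordered t = ∀ x → t (openIx {k} x) Fin.≤ t (closeIx x)

  Between : WordS s n → State → State → Dom n → Dom n → Tuple → Set
  Between w p q x y t = toℕ x ℕ.< toℕ y × Segment w t p q (suc (toℕ x)) (toℕ y)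

  Prefix : WordS s n → State → Dom n → Tuple → Set
  Prefix w q y t = Segment w t start q 0 (toℕ y)

  Suffix : WordS s n → State → Dom n → Tuple → Set
  Suffix w p x t = toℕ x ℕ.< n × ∃[ qf ] T (final qf) × Segment w t p qf (suc (toℕ x)) (suc n)

  Accepting : WordS s n → Tuple → Set
  Accepting w t = Ordered t × ∃[ qf ] T (final qf) × Segment w t start qf 0 (suc n)

  module Update (w : WordS s n) (op : Op s) (u : Dom n) (t : Tuple) where

    private
      w′ = applyW w op u
      U = toℕ u

    Between-inside : ∀ {p q x y} → toℕ x ℕ.< U → U ℕ.< toℕ y →
      Between w′ p q x y t ⇔ (∃[ r ] ∃[ r′ ] Between w p r x u t × BlockAt w′ t U r r′ × Between w r′ q u y t)
    Between-inside x<U U<y = mk⇔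
      (λ (_ , seg) → let (r , r′ , seg₁ , block , seg₂) = to split seg in r , r′ , (x<U , seg₁) , block , (U<y , seg₂))
      (λ (r , r′ , (_ , seg₁) , block , (_ , seg₂)) → ℕₚ.<-trans x<U U<y , from split (r , r′ , seg₁ , block , seg₂))
      where split = Segment-applyW-split w op u t x<U U<y

    Between-outside : ∀ {p q x y} → ¬ (toℕ x ℕ.< U × U ℕ.< toℕ y) → Between w′ p q x y t ⇔ Between w p q x y t
    Between-outside out = mk⇔ (λ (x<y , seg) → x<y , to same seg) (λ (x<y , seg) → x<y , from same seg)
      where same = Segment-applyW-outside w op u t out

    Prefix-inside : ∀ {q y} → U ℕ.< toℕ y →
      Prefix w′ q y t ⇔ (∃[ r ] ∃[ r′ ] Prefix w r u t × BlockAt w′ t U r r′ × Between w r′ q u y t)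
    Prefix-inside U<y = mk⇔
      (λ seg → let (r , r′ , seg₁ , block , seg₂) = to split seg in r , r′ , seg₁ , block , (U<y , seg₂))
      (λ (r , r′ , seg₁ , block , (_ , seg₂)) → from split (r , r′ , seg₁ , block , seg₂))
      where split = Segment-applyW-split w op u t z≤n U<y

    Prefix-outside : ∀ {q y} → ¬ U ℕ.< toℕ y → Prefix w′ q y t ⇔ Prefix w q y t
    Prefix-outside out = Segment-applyW-outside w op u t (out ∘ proj₂)

    Suffix-inside : ∀ {p x} → toℕ x ℕ.< U → U ℕ.< n →
      Suffix w′ p x t ⇔ (∃[ r ] ∃[ r′ ] Between w p r x u t × BlockAt w′ t U r r′ × Suffix w r′ u t)
    Suffix-inside x<U U<n = mk⇔
      (λ (_ , qf , final , seg) → let (r , r′ , seg₁ , block , seg₂) = to (split qf) seg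
                                  in r , r′ , (x<U , seg₁) , block , (U<n , qf , final , seg₂))
      (λ (r , r′ , (_ , seg₁) , block , (_ , qf , final , seg₂)) →
         ℕₚ.<-trans x<U U<n , qf , final , from (split qf) (r , r′ , seg₁ , block , seg₂))
      where split = λ qf → Segment-applyW-split w op u t {q = qf} x<U (ℕₚ.m<n⇒m<1+n U<n)

    Suffix-outside : ∀ {p x} → ¬ toℕ x ℕ.< U → Suffix w′ p x t ⇔ Suffix w p x t
    Suffix-outside out = mk⇔ (λ (x<n , qf , final , seg) → x<n , qf , final , to (same qf) seg)
                             (λ (x<n , qf , final , seg) → x<n , qf , final , from (same qf) seg)
      where same = λ qf → Segment-applyW-outside w op u t {q = qf} {b = suc n} (out ∘ proj₁)

    Accepting-split : U ℕ.< n →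
      Accepting w′ t ⇔ (Ordered t × ∃[ r ] ∃[ r′ ] Prefix w r u t × BlockAt w′ t U r r′ × Suffix w r′ u t)
    Accepting-split U<n = mk⇔
      (λ (ord , qf , final , seg) → let (r , r′ , seg₁ , block , seg₂) = to (split qf) seg
                                    in ord , r , r′ , seg₁ , block , (U<n , qf , final , seg₂))
      (λ (ord , r , r′ , seg₁ , block , (_ , qf , final , seg₂)) →
         ord , qf , final , from (split qf) (r , r′ , seg₁ , block , seg₂))
      where split = λ qf → Segment-applyW-split w op u t {q = qf} z≤n (ℕₚ.m<n⇒m<1+n U<n)

  Unmarked : Tuple → ℕ → ℕ → Set
  Unmarked t a b = ∀ idx → a ℕ.≤ toℕ (t idx) → ¬ toℕ (t idx) ℕ.< b

  markersAt-silent : ∀ t i → (∀ idx → toℕ (t idx) ≢ i) → ∀ idx → markersAt t i idx ≡ false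
  markersAt-silent t i unmarked idx = dec-false (toℕ (t idx) ℕ.≟ i) (unmarked idx)

  markersAt-silent⁻ : ∀ t i → (∀ idx → markersAt t i idx ≡ false) → ∀ idx → toℕ (t idx) ≢ i
  markersAt-silent⁻ t i silent idx e = contradiction (dec-true (toℕ (t idx) ℕ.≟ i) e) (λ e′ → case trans (sym e′) (silent idx) of λ ())

  BlockAt-empty : ∀ {t i p q} → i ℕ.< n → BlockAt emptyW t i p q ⇔ ((∀ idx → toℕ (t idx) ≢ i) × Path A p [] q)
  BlockAt-empty {t} {i} {p} {q} i<n rewrite atℕ-nothing {suc n} {Fin s} i | dec-false (i ℕ.≟ n) (ℕₚ.<⇒≢ i<n) = mk⇔
    (λ block → let (silent , π) = to BlockStep-silent block in markersAt-silent⁻ t i silent , π)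
    (λ (unmarked , π) → from BlockStep-silent (markersAt-silent t i unmarked , π))

  Run-empty : ∀ {t p q} a len → (∀ i → a ℕ.≤ i → i ℕ.< a + len → i ℕ.< n) →
              Run emptyW t p q a len ⇔ (Unmarked t a (a + len) × Path A p [] q)
  Run-empty {t} a zero _ = mk⇔ (λ π → (λ idx a≤i i<a → ℕₚ.≤⇒≯ a≤i (subst (_ ℕ.<_) (ℕₚ.+-identityʳ a) i<a)) , π) proj₂
  Run-empty {t} {p} {q} a (suc len) inside = mk⇔
    (λ (m , block , r) →
       let (unmarkedₐ , π₁) = to (BlockAt-empty a<n) block
           (unmarked , π₂) = to (rest m) r
       in (λ idx a≤i i< → [ (λ a<i → unmarked idx a<i (subst (toℕ (t idx) ℕ.<_) (ℕₚ.+-suc a len) i<)) , (λ a≡i → unmarkedₐ idx (sym a≡i)) ]′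
                           (ℕₚ.m≤n⇒m<n∨m≡n a≤i)) ,
          Path-++⁺ π₁ π₂)
    (λ (unmarked , π) →
       p , from (BlockAt-empty a<n) ((λ idx i≡a → unmarked idx (ℕₚ.≤-reflexive (sym i≡a)) (subst (ℕ._< a + suc len) (sym i≡a) (ℕₚ.m<m+n a (s≤s z≤n)))) , here) ,
           from (rest p) ((λ idx a<i i< → unmarked idx (ℕₚ.<⇒≤ a<i) (subst (toℕ (t idx) ℕ.<_) (sym (ℕₚ.+-suc a len)) i<)) , π))
    where
    a<n : a ℕ.< n
    a<n = inside a ℕₚ.≤-refl (ℕₚ.m<m+n a (s≤s z≤n))
    rest : ∀ m → Run emptyW t m q (suc a) len ⇔ (Unmarked t (suc a) (suc a + len) × Path A m [] q)
    rest m = Run-empty (suc a) len λ i a<i i< → inside i (ℕₚ.<⇒≤ a<i) (subst (i ℕ.<_) (sym (ℕₚ.+-suc a len)) i<)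

  Segment-empty : ∀ {t p q a b} → b ℕ.≤ n → Segment emptyW t p q a b ⇔ (Unmarked t a b × Path A p [] q)
  Segment-empty {t} {p} {q} {a} {b} b≤n = mk⇔
    (λ seg → let (unmarked , π) = to run seg in (λ idx a≤i i<b → unmarked idx a≤i (from (<-+∸⇔< a≤i) i<b)) , π)
    (λ (unmarked , π) → from run ((λ idx a≤i i< → unmarked idx a≤i (to (<-+∸⇔< a≤i) i<)) , π))
    where
    run = Run-empty {t} {p} {q} a (b ∸ a) λ i a≤i i< → ℕₚ.<-≤-trans (to (<-+∸⇔< a≤i) i<) b≤n

  AcceptingEnd : Markers → State → Set
  AcceptingEnd σ p = ∃[ qf ] T (final qf) × BlockStep σ nothing true p qf

  Segment-empty-end : ∀ {t p a} → a ℕ.≤ n →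
    (∃[ qf ] T (final qf) × Segment emptyW t p qf a (suc n)) ⇔ (Unmarked t a n × AcceptingEnd (markersAt t n) p)
  Segment-empty-end {t} {p} {a} a≤n = mk⇔
    (λ (qf , final , seg) →
       let (m , m′ , seg₁ , block , π₂) = to (split qf) seg
           (unmarked , π₁) = to (Segment-empty ℕₚ.≤-refl) seg₁
       in unmarked , qf , final , BlockStep-ε-around {markersAt t n} {nothing} {true} π₁ (subst id endBlock block) (to Segment-here π₂))
    (λ (unmarked , qf , final , block) →
       qf , final , from (split qf) (p , qf , from (Segment-empty ℕₚ.≤-refl) (unmarked , here) , subst id (sym endBlock) block , from Segment-here here))
    where
    split = λ qf → Segment-split {emptyW} {t} {p} {qf} {a} {n} {suc n} a≤n (ℕₚ.n<1+n n)
    endBlock : ∀ {m m′} → BlockAt emptyW t n m m′ ≡ BlockStep (markersAt t n) nothing true m m′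
    endBlock rewrite atℕ-nothing {suc n} {Fin s} n | dec-true (n ℕ.≟ n) refl = refl

  module Initial (t : Tuple) where

    Between-empty : ∀ {p q x y} → Between emptyW p q x y t ⇔
                    (toℕ x ℕ.< toℕ y × Unmarked t (suc (toℕ x)) (toℕ y) × Path A p [] q)
    Between-empty {y = y} = mk⇔ (λ (x<y , seg) → x<y , to empty seg) (λ (x<y , rest) → x<y , from empty rest)
      where empty = Segment-empty (Finₚ.toℕ≤pred[n] y)

    Prefix-empty : ∀ {q y} → Prefix emptyW q y t ⇔ (Unmarked t 0 (toℕ y) × Path A start [] q)
    Prefix-empty {y = y} = Segment-empty (Finₚ.toℕ≤pred[n] y)

    Suffix-empty : ∀ {p x} → Suffix emptyW p x t ⇔
                   (toℕ x ℕ.< n × Unmarked t (suc (toℕ x)) n × AcceptingEnd (markersAt t n) p)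
    Suffix-empty = mk⇔ (λ (x<n , rest) → x<n , to (Segment-empty-end x<n) rest)
                       (λ (x<n , rest) → x<n , from (Segment-empty-end x<n) rest)

    Accepting-empty : Accepting emptyW t ⇔ (Ordered t × Unmarked t 0 n × AcceptingEnd (markersAt t n) start)
    Accepting-empty = mk⇔ (λ (ord , rest) → ord , to (Segment-empty-end z≤n) rest)
                          (λ (ord , rest) → ord , from (Segment-empty-end z≤n) rest)

-- The quantifier-free dynamic program

module Formulas {s τ : ℕ} {ar : Fin τ → ℕ} where

  Fm : ℕ → Set
  Fm = Formula s τ ar

  constᶠ : ∀ {m} → Bool → Fm m
  constᶠ true = tt
  constᶠ false = neg tt

  ⋁ : ∀ {m N} → (Fin N → Fm m) → Fm m
  ⋁ {N = zero} φ = neg tt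
  ⋁ {N = suc N} φ = or (φ zero) (⋁ (φ ∘ suc))

  ⋀ : ∀ {m N} → (Fin N → Fm m) → Fm m
  ⋀ {N = zero} φ = tt
  ⋀ {N = suc N} φ = and (φ zero) (⋀ (φ ∘ suc))

  consᵇ : ∀ {m} → Bool → (Fin m → Bool) → Fin (suc m) → Bool
  consᵇ b σ zero = b
  consᵇ b σ (suc i) = σ i

  -- Branches on the equality type of the terms ts against z, handing it to φ as a Boolean vector.
  caseOn : ∀ {m m′} → (Fin m′ → Term m) → Term m → ((Fin m′ → Bool) → Fm m) → Fm m
  caseOn {m′ = zero} ts z φ = φ λ ()
  caseOn {m′ = suc m′} ts z φ =
    or (and (eq (ts zero) z) (caseOn (ts ∘ suc) z (φ ∘ consᵇ true)))
       (and (neg (eq (ts zero) z)) (caseOn (ts ∘ suc) z (φ ∘ consᵇ false)))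

  qf-constᶠ : ∀ {m} b → QF (constᶠ {m} b)
  qf-constᶠ true = tt
  qf-constᶠ false = neg tt

  qf-⋁ : ∀ {m N} {φ : Fin N → Fm m} → (∀ i → QF (φ i)) → QF (⋁ φ)
  qf-⋁ {N = zero} qf = neg tt
  qf-⋁ {N = suc N} qf = or (qf zero) (qf-⋁ (qf ∘ suc))

  qf-⋀ : ∀ {m N} {φ : Fin N → Fm m} → (∀ i → QF (φ i)) → QF (⋀ φ)
  qf-⋀ {N = zero} qf = tt
  qf-⋀ {N = suc N} qf = and (qf zero) (qf-⋀ (qf ∘ suc))

  qf-caseOn : ∀ {m m′} (ts : Fin m′ → Term m) z {φ} → (∀ σ → QF (φ σ)) → QF (caseOn ts z φ)
  qf-caseOn {m′ = zero} ts z qf = qf _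
  qf-caseOn {m′ = suc m′} ts z qf = or (and eq (qf-caseOn (ts ∘ suc) z (qf ∘ _))) (and (neg eq) (qf-caseOn (ts ∘ suc) z (qf ∘ _)))

  module _ {n : ℕ} (w : WordS s n) (R : AuxRels n τ ar) where

    Sat-constᶠ : ∀ {m} b (ρ : Fin m → Dom n) → Sat w R (constᶠ b) ρ ⇔ T b
    Sat-constᶠ true ρ = mk⇔ id id
    Sat-constᶠ false ρ = mk⇔ (λ ¬⊤ → ¬⊤ tt) λ ()

    Sat-⋁ : ∀ {m N} (φ : Fin N → Fm m) ρ → Sat w R (⋁ φ) ρ ⇔ (∃[ i ] Sat w R (φ i) ρ)
    Sat-⋁ {N = zero} φ ρ = mk⇔ (λ ¬⊤ → ⊥-elim (¬⊤ tt)) λ ()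
    Sat-⋁ {N = suc N} φ ρ = mk⇔
      [ (zero ,_) , (λ sat → let (i , satᵢ) = to (Sat-⋁ (φ ∘ suc) ρ) sat in suc i , satᵢ) ]′
      λ { (zero , sat) → inj₁ sat ; (suc i , sat) → inj₂ (from (Sat-⋁ (φ ∘ suc) ρ) (i , sat)) }

    Sat-⋀ : ∀ {m N} (φ : Fin N → Fm m) ρ → Sat w R (⋀ φ) ρ ⇔ (∀ i → Sat w R (φ i) ρ)
    Sat-⋀ {N = zero} φ ρ = mk⇔ (λ _ ()) (λ _ → tt)
    Sat-⋀ {N = suc N} φ ρ = mk⇔
      (λ { (sat₀ , sat) zero → sat₀ ; (sat₀ , sat) (suc i) → to (Sat-⋀ (φ ∘ suc) ρ) sat i })
      (λ sat → sat zero , from (Sat-⋀ (φ ∘ suc) ρ) (sat ∘ suc))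

    Sat-caseOn : ∀ {m m′} (ts : Fin m′ → Term m) z (φ : (Fin m′ → Bool) → Fm m) ρ →
      (∀ {σ σ′} → (∀ i → σ i ≡ σ′ i) → Sat w R (φ σ) ρ → Sat w R (φ σ′) ρ) →
      Sat w R (caseOn ts z φ) ρ ⇔ Sat w R (φ λ i → does (evalT ρ (ts i) Fin.≟ evalT ρ z)) ρ
    Sat-caseOn {m′ = zero} ts z φ ρ resp = mk⇔ (resp λ ()) (resp λ ())
    Sat-caseOn {m′ = suc m′} ts z φ ρ resp with evalT ρ (ts zero) Fin.≟ evalT ρ z in eq₀
    ... | yes e = mk⇔
      [ (λ (_ , sat) → resp (sym ∘ head≡) (to ih sat)) , (λ (ne , _) → contradiction e ne) ]′
      (λ sat → inj₁ (e , from ih (resp head≡ sat)))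
      where
      ih = Sat-caseOn (ts ∘ suc) z (φ ∘ consᵇ true) ρ λ σ≗σ′ → resp λ { zero → refl ; (suc i) → σ≗σ′ i }
      head≡ : ∀ i → does (evalT ρ (ts i) Fin.≟ evalT ρ z) ≡ consᵇ true (λ i → does (evalT ρ (ts (suc i)) Fin.≟ evalT ρ z)) i
      head≡ zero rewrite eq₀ = refl
      head≡ (suc i) = refl
    ... | no ne = mk⇔
      [ (λ (e , _) → contradiction e ne) , (λ (_ , sat) → resp (sym ∘ head≡) (to ih sat)) ]′
      (λ sat → inj₂ (ne , from ih (resp head≡ sat)))
      where
      ih = Sat-caseOn (ts ∘ suc) z (φ ∘ consᵇ false) ρ λ σ≗σ′ → resp λ { zero → refl ; (suc i) → σ≗σ′ i }
      head≡ : ∀ i → does (evalT ρ (ts i) Fin.≟ evalT ρ z) ≡ consᵇ false (λ i → does (evalT ρ (ts (suc i)) Fin.≟ evalT ρ z)) i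
      head≡ zero rewrite eq₀ = refl
      head≡ (suc i) = refl

pattern between = zero
pattern prefix = suc zero
pattern suffix = suc (suc zero)

module Program {s k : ℕ} (A : VSA s k) where
  open VSA A
  open RefWords {s} {k}
  open Automaton A

  Kind : Set
  Kind = Fin 3

  Aux : Set
  Aux = Kind × State × State

  M : ℕ
  M = 3 * (nStates * nStates)

  encode : Aux → Fin M
  encode (κ , p , q) = Fin.combine κ (Fin.combine p q)

  decode : Fin M → Aux
  decode j = unpair (Fin.remQuot {3} (nStates * nStates) j)
    where unpair : Kind × Fin (nStates * nStates) → Aux
          unpair (κ , pq) = κ , Fin.remQuot {nStates} nStates pq

  decode-encode : ∀ a → decode (encode a) ≡ a
  decode-encode (κ , p , q) =
    trans (cong (λ (κ , pq) → κ , Fin.remQuot {nStates} nStates pq) (Finₚ.remQuot-combine {3} {nStates * nStates} κ (Fin.combine p q)))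
          (cong (κ ,_) (Finₚ.remQuot-combine {nStates} {nStates} p q))

  -- Relation zero is the spanner relation; relation suc (encode (κ , p , q)) has arguments
  -- (x , y , t̄) and means Between, Prefix or Suffix according to the kind κ (Prefix ignores p,
  -- Suffix ignores q).
  arity : Fin (suc M) → ℕ
  arity zero = k * 2
  arity (suc _) = suc (suc (k * 2))

  acceptingEnd? : ∀ σ p → Dec (∃[ qf ] T (final qf) × BlockStep σ nothing true p qf)
  acceptingEnd? σ p = Finₚ.any? λ qf → T? (final qf) ×-dec blockStep? σ nothing true p qf

  orderedᶠ : ∀ {τ ar m} → (Fin (k * 2) → Term m) → Formula s τ ar m
  orderedᶠ ts = Formulas.⋀ λ x → or (lt (ts (openIx {k} x)) (ts (closeIx x))) (eq (ts (openIx {k} x)) (ts (closeIx x)))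

  qf-orderedᶠ : ∀ {τ ar m} (ts : Fin (k * 2) → Term m) → QF (orderedᶠ {τ} {ar} ts)
  qf-orderedᶠ ts = Formulas.qf-⋀ λ x → or lt eq

  module UpdateFormulas {m : ℕ} where
    open Formulas {s} {suc M} {arity}

    args : Term m → Term m → (Fin (k * 2) → Term m) → Fin (suc (suc (k * 2))) → Term m
    args X Y ts zero = X
    args X Y ts (suc zero) = Y
    args X Y ts (suc (suc i)) = ts i

    auxᶠ : Aux → Term m → Term m → (Fin (k * 2) → Term m) → Fm m
    auxᶠ a X Y ts = rel (suc (encode a)) (args X Y ts)

    blockᶠ : Maybe (Fin s) → Term m → (Fin (k * 2) → Term m) → State → State → Fm m
    blockᶠ c U ts r r′ = caseOn ts U λ σ → constᶠ (does (blockStep? σ c false r r′))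

    throughᶠ : Maybe (Fin s) → Term m → (Fin (k * 2) → Term m) → (State → Fm m) → (State → Fm m) → Fm m
    throughᶠ c U ts before after = ⋁ λ r → ⋁ λ r′ → and (before r) (and (blockᶠ c U ts r r′) (after r′))

    -- c is the letter written at position U.
    updateᶠ : Maybe (Fin s) → Aux → Term m → Term m → Term m → (Fin (k * 2) → Term m) → Fm m
    updateᶠ c (between , p , q) U X Y ts =
      or (and (and (lt X U) (lt U Y)) (throughᶠ c U ts (λ r → auxᶠ (between , p , r) X U ts) (λ r′ → auxᶠ (between , r′ , q) U Y ts)))
         (and (neg (and (lt X U) (lt U Y))) (auxᶠ (between , p , q) X Y ts))
    updateᶠ c (prefix , _ , q) U X Y ts =
      or (and (lt U Y) (throughᶠ c U ts (λ r → auxᶠ (prefix , r , r) U U ts) (λ r′ → auxᶠ (between , r′ , q) U Y ts)))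
         (and (neg (lt U Y)) (auxᶠ (prefix , q , q) Y Y ts))
    updateᶠ c (suffix , p , _) U X Y ts =
      or (and (lt X U) (throughᶠ c U ts (λ r → auxᶠ (between , p , r) X U ts) (λ r′ → auxᶠ (suffix , r′ , r′) U U ts)))
         (and (neg (lt X U)) (auxᶠ (suffix , p , p) X X ts))

    updateOutᶠ : Maybe (Fin s) → Term m → (Fin (k * 2) → Term m) → Fm m
    updateOutᶠ c U ts =
      and (orderedᶠ ts) (throughᶠ c U ts (λ r → auxᶠ (prefix , r , r) U U ts) (λ r′ → auxᶠ (suffix , r′ , r′) U U ts))

    qf-throughᶠ : ∀ c U ts {before after} → (∀ r → QF (before r)) → (∀ r → QF (after r)) → QF (throughᶠ c U ts before after)
    qf-throughᶠ c U ts qf₁ qf₂ = qf-⋁ λ r → qf-⋁ λ r′ → and (qf₁ r) (and (qf-caseOn ts U λ _ → qf-constᶠ _) (qf₂ r′))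

    qf-updateᶠ : ∀ c a U X Y ts → QF (updateᶠ c a U X Y ts)
    qf-updateᶠ c (between , p , q) U X Y ts = or (and (and lt lt) (qf-throughᶠ c U ts (λ _ → rel) (λ _ → rel))) (and (neg (and lt lt)) rel)
    qf-updateᶠ c (prefix , p , q) U X Y ts = or (and lt (qf-throughᶠ c U ts (λ _ → rel) (λ _ → rel))) (and (neg lt) rel)
    qf-updateᶠ c (suffix , p , q) U X Y ts = or (and lt (qf-throughᶠ c U ts (λ _ → rel) (λ _ → rel))) (and (neg lt) rel)

    qf-updateOutᶠ : ∀ c U ts → QF (updateOutᶠ c U ts)
    qf-updateOutᶠ c U ts = and (qf-orderedᶠ ts) (qf-throughᶠ c U ts (λ _ → rel) (λ _ → rel))

  module InitFormulas {m : ℕ} where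
    open Formulas {s} {0} {noAux}

    unmarkedᶠ : Term m → Term m → (Fin (k * 2) → Term m) → Fm m
    unmarkedᶠ X Y ts = ⋀ λ i → neg (and (lt X (ts i)) (lt (ts i) Y))

    unmarkedBelowᶠ : Term m → (Fin (k * 2) → Term m) → Fm m
    unmarkedBelowᶠ Y ts = ⋀ λ i → neg (lt (ts i) Y)

    acceptingEndᶠ : (Fin (k * 2) → Term m) → State → Fm m
    acceptingEndᶠ ts p = caseOn ts $t λ σ → constᶠ (does (acceptingEnd? σ p))

    initᶠ : Aux → Term m → Term m → (Fin (k * 2) → Term m) → Fm m
    initᶠ (between , p , q) X Y ts = and (lt X Y) (and (unmarkedᶠ X Y ts) (constᶠ (does (path? p [] q))))
    initᶠ (prefix , _ , q) X Y ts = and (unmarkedBelowᶠ Y ts) (constᶠ (does (path? start [] q)))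
    initᶠ (suffix , p , _) X Y ts = and (lt X $t) (and (unmarkedᶠ X $t ts) (acceptingEndᶠ ts p))

    initOutᶠ : (Fin (k * 2) → Term m) → Fm m
    initOutᶠ ts = and (orderedᶠ ts) (and (unmarkedBelowᶠ $t ts) (acceptingEndᶠ ts start))

  program : DynProg s
  program = record
    { τ = suc M
    ; ar = arity
    ; init = λ { zero → InitFormulas.initOutᶠ var
               ; (suc j) → InitFormulas.initᶠ (decode j) (var zero) (var (suc zero)) (λ i → var (suc (suc i))) }
    ; upd = λ { op zero → UpdateFormulas.updateOutᶠ (newLetter op) (var zero) (λ i → var (suc i))
              ; op (suc j) → UpdateFormulas.updateᶠ (newLetter op) (decode j) (var zero) (var (suc zero))
                                                    (var (suc (suc zero))) (λ i → var (suc (suc (suc i)))) }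
    }

  program-QF : IsDynPROP program
  program-QF op zero = UpdateFormulas.qf-updateOutᶠ _ _ _
  program-QF op (suc j) = UpdateFormulas.qf-updateᶠ _ (decode j) _ _ _ _

module Maintenance {s k : ℕ} (A : VSA s k) (n : ℕ) where
  open VSA A
  open RefWords {s} {k}
  open Automaton A
  open Runs A n
  open Program A

  AuxHolds : WordS s n → Aux → Dom n → Dom n → Tuple → Set
  AuxHolds w (between , p , q) x y t = Between w p q x y t
  AuxHolds w (prefix , _ , q) x y t = Prefix w q y t
  AuxHolds w (suffix , p , _) x y t = Suffix w p x t

  Invariant : WordS s n → AuxRels n (suc M) arity → Set
  Invariant w R = w (dollar n) ≡ nothing
                × (∀ t → R zero t ⇔ Accepting w t)
                × (∀ j f → R (suc j) f ⇔ AuxHolds w (decode j) (f zero) (f (suc zero)) (λ i → f (suc (suc i))))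

  module _ {τ ar} (w : WordS s n) (R : AuxRels n τ ar) where
    open Formulas {s} {τ} {ar}

    Sat-orderedᶠ : ∀ {m} (ρ : Fin m → Dom n) ts → Sat w R (orderedᶠ ts) ρ ⇔ Ordered (λ i → evalT ρ (ts i))
    Sat-orderedᶠ ρ ts = ⇔-trans (Sat-⋀ w R _ ρ) (mk⇔ (λ sat x → from Fin-≤⇔<⊎≡ (sat x)) (λ ord x → to Fin-≤⇔<⊎≡ (ord x)))

    Sat-decide : ∀ {m} {P : Set} (d : Dec P) (ρ : Fin m → Dom n) → Sat w R (constᶠ (does d)) ρ ⇔ P
    Sat-decide d ρ = ⇔-trans (Sat-constᶠ w R (does d) ρ) (T-does d)

    Sat-caseOn-markers : ∀ {m} {P : Markers → Set} (P? : ∀ σ → Dec (P σ)) → (∀ {σ σ′} → σ ≗ σ′ → P σ → P σ′) →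
      ∀ (ρ : Fin m → Dom n) ts z i → evalT ρ z ≡ i →
      Sat w R (caseOn ts z λ σ → constᶠ (does (P? σ))) ρ ⇔ P (markersAt (λ j → evalT ρ (ts j)) (toℕ i))
    Sat-caseOn-markers P? P-cong ρ ts z i z≡i =
      ⇔-trans (Sat-caseOn w R ts z _ ρ λ σ≗σ′ sat → from (Sat-decide (P? _) ρ) (P-cong σ≗σ′ (to (Sat-decide (P? _) ρ) sat)))
      (⇔-trans (Sat-decide (P? _) ρ) (mk⇔ (P-cong σ≗markers) (P-cong (sym ∘ σ≗markers))))
      where
      σ≗markers : (λ j → does (evalT ρ (ts j) Fin.≟ evalT ρ z)) ≗ markersAt (λ j → evalT ρ (ts j)) (toℕ i)
      σ≗markers j = trans (does-≟-toℕ (evalT ρ (ts j)) (evalT ρ z)) (cong (λ i → does (toℕ (evalT ρ (ts j)) ℕ.≟ toℕ i)) z≡i)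

  module Step (w : WordS s n) (R : AuxRels n (suc M) arity) (inv : Invariant w R) (op : Op s) (u : Dom n) (u<n : toℕ u ℕ.< n) where
    open Formulas {s} {suc M} {arity}
    open UpdateFormulas

    private
      w′ = applyW w op u
      c = newLetter op

    Sat-auxᶠ : ∀ {m} (ρ : Fin m → Dom n) a X Y ts →
      Sat w′ R (auxᶠ a X Y ts) ρ ⇔ AuxHolds w a (evalT ρ X) (evalT ρ Y) (λ i → evalT ρ (ts i))
    Sat-auxᶠ ρ a X Y ts =
      subst (λ a′ → R (suc (encode a)) _ ⇔ AuxHolds w a′ (evalT ρ X) (evalT ρ Y) (λ i → evalT ρ (ts i)))
            (decode-encode a) (proj₂ (proj₂ inv) (encode a) λ l → evalT ρ (args X Y ts l))

    BlockAt-updated : ∀ {t r r′} → BlockAt w′ t (toℕ u) r r′ ≡ BlockStep (markersAt t (toℕ u)) c false r r′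
    BlockAt-updated rewrite atℕ-applyW-at w op u | dec-false (toℕ u ℕ.≟ n) (ℕₚ.<⇒≢ u<n) = refl

    Sat-throughᶠ : ∀ {m} (ρ : Fin m → Dom n) U ts → evalT ρ U ≡ u → ∀ before after →
      Sat w′ R (throughᶠ c U ts before after) ρ ⇔
      (∃[ r ] ∃[ r′ ] Sat w′ R (before r) ρ × BlockAt w′ (λ i → evalT ρ (ts i)) (toℕ u) r r′ × Sat w′ R (after r′) ρ)
    Sat-throughᶠ ρ U ts U≡u before after = mk⇔
      (λ sat → let (r , sat₁) = to (outer) sat
                   (r′ , sat-before , sat-block , sat-after) = to (inner r) sat₁
               in r , r′ , sat-before , to (block r r′) sat-block , sat-after)
      (λ (r , r′ , sat-before , blk , sat-after) →
         from outer (r , from (inner r) (r′ , sat-before , from (block r r′) blk , sat-after)))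
      where
      via : State → State → Fm _
      via r r′ = and (before r) (and (blockᶠ c U ts r r′) (after r′))
      outer = Sat-⋁ w′ R (λ r → ⋁ (via r)) ρ
      inner = λ r → Sat-⋁ w′ R (via r) ρ
      block : ∀ r r′ → Sat w′ R (blockᶠ c U ts r r′) ρ ⇔ BlockAt w′ (λ i → evalT ρ (ts i)) (toℕ u) r r′
      block r r′ = subst (Sat w′ R (blockᶠ c U ts r r′) ρ ⇔_) (sym (BlockAt-updated {λ i → evalT ρ (ts i)}))
        (Sat-caseOn-markers w′ R (λ σ → blockStep? σ c false r r′) BlockStep-cong ρ ts U u U≡u)

    module _ (f : Fin (suc (suc (k * 2))) → Dom n) where
      private
        ρ = extend u f
        x = f zero
        y = f (suc zero)
        t : Tuple
        t i = f (suc (suc i))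
        ts : Fin (k * 2) → Term (suc (suc (suc (k * 2))))
        ts i = var (suc (suc (suc i)))
        U X Y : Term (suc (suc (suc (k * 2))))
        U = var zero
        X = var (suc zero)
        Y = var (suc (suc zero))
        through = Sat-throughᶠ ρ U ts refl
      open Update w op u t

      Sat-updateᶠ : ∀ a → Sat w′ R (updateᶠ c a U X Y ts) ρ ⇔ AuxHolds w′ a x y t
      Sat-updateᶠ (between , p , q) =
        ⇔-by-cases (toℕ x ℕ.<? toℕ u ×-dec toℕ u ℕ.<? toℕ y)
          (λ (x<u , u<y) → ⇔-trans (through _ _)
                           (⇔-trans (∃²-cong (λ r → Sat-auxᶠ ρ (between , p , r) X U ts) (λ r′ → Sat-auxᶠ ρ (between , r′ , q) U Y ts))
                                    (⇔-sym (Between-inside x<u u<y))))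
          (λ out → ⇔-trans (Sat-auxᶠ ρ (between , p , q) X Y ts) (⇔-sym (Between-outside out)))
      Sat-updateᶠ (prefix , _ , q) =
        ⇔-by-cases (toℕ u ℕ.<? toℕ y)
          (λ u<y → ⇔-trans (through _ _)
                   (⇔-trans (∃²-cong (λ r → Sat-auxᶠ ρ (prefix , r , r) U U ts) (λ r′ → Sat-auxᶠ ρ (between , r′ , q) U Y ts))
                            (⇔-sym (Prefix-inside u<y))))
          (λ out → ⇔-trans (Sat-auxᶠ ρ (prefix , q , q) Y Y ts) (⇔-sym (Prefix-outside out)))
      Sat-updateᶠ (suffix , p , _) =
        ⇔-by-cases (toℕ x ℕ.<? toℕ u)
          (λ x<u → ⇔-trans (through _ _)
                   (⇔-trans (∃²-cong (λ r → Sat-auxᶠ ρ (between , p , r) X U ts) (λ r′ → Sat-auxᶠ ρ (suffix , r′ , r′) U U ts))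
                            (⇔-sym (Suffix-inside x<u u<n))))
          (λ out → ⇔-trans (Sat-auxᶠ ρ (suffix , p , p) X X ts) (⇔-sym (Suffix-outside out)))

    Sat-updateOutᶠ : ∀ t → Sat w′ R (updateOutᶠ c (var zero) (λ i → var (suc i))) (extend u t) ⇔ Accepting w′ t
    Sat-updateOutᶠ t = ⇔-trans (Sat-orderedᶠ w′ R ρ ts ×-⇔ ⇔-trans (Sat-throughᶠ ρ (var zero) ts refl _ _)
                                 (∃²-cong (λ r → Sat-auxᶠ ρ (prefix , r , r) (var zero) (var zero) ts)
                                          (λ r′ → Sat-auxᶠ ρ (suffix , r′ , r′) (var zero) (var zero) ts)))
                               (⇔-sym (Update.Accepting-split w op u t u<n))
      where
      ρ = extend u t
      ts : Fin (k * 2) → Term (suc (k * 2))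
      ts i = var (suc i)

  AcceptingEnd-cong : ∀ {σ σ′ p} → σ ≗ σ′ → AcceptingEnd σ p → AcceptingEnd σ′ p
  AcceptingEnd-cong σ≗σ′ (qf , final , block) = qf , final , BlockStep-cong {e = true} σ≗σ′ block

  <$⇔<n : ∀ {a} → (a ℕ.< toℕ (dollar n)) ⇔ (a ℕ.< n)
  <$⇔<n {a} = mk⇔ (subst (a ℕ.<_) (Finₚ.toℕ-fromℕ n)) (subst (a ℕ.<_) (sym (Finₚ.toℕ-fromℕ n)))

  module Init where
    open Formulas {s} {0} {noAux}
    open InitFormulas

    module _ {m : ℕ} (ρ : Fin m → Dom n) (ts : Fin (k * 2) → Term m) where
      private
        t : Tuple
        t i = evalT ρ (ts i)

      Sat-acceptingEndᶠ : ∀ p → Sat emptyW noRels (acceptingEndᶠ ts p) ρ ⇔ AcceptingEnd (markersAt t n) p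
      Sat-acceptingEndᶠ p =
        subst (λ i → Sat emptyW noRels (acceptingEndᶠ ts p) ρ ⇔ AcceptingEnd (markersAt t i) p) (Finₚ.toℕ-fromℕ n)
              (Sat-caseOn-markers emptyW noRels (λ σ → acceptingEnd? σ p) AcceptingEnd-cong ρ ts $t (dollar n) refl)

      Sat-unmarkedᶠ : ∀ X Y → Sat emptyW noRels (unmarkedᶠ X Y ts) ρ ⇔ Unmarked t (suc (toℕ (evalT ρ X))) (toℕ (evalT ρ Y))
      Sat-unmarkedᶠ X Y = ⇔-trans (Sat-⋀ emptyW noRels _ ρ)
        (mk⇔ (λ sat idx x<i i<y → sat idx (x<i , i<y)) (λ unmarked idx (x<i , i<y) → unmarked idx x<i i<y))

      Sat-unmarkedBelowᶠ : ∀ Y → Sat emptyW noRels (unmarkedBelowᶠ Y ts) ρ ⇔ Unmarked t 0 (toℕ (evalT ρ Y))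
      Sat-unmarkedBelowᶠ Y = ⇔-trans (Sat-⋀ emptyW noRels _ ρ)
        (mk⇔ (λ sat idx _ i<y → sat idx i<y) (λ unmarked idx i<y → unmarked idx z≤n i<y))

      Sat-unmarked$ᶠ : ∀ X → Sat emptyW noRels (unmarkedᶠ X $t ts) ρ ⇔ Unmarked t (suc (toℕ (evalT ρ X))) n
      Sat-unmarked$ᶠ X = ⇔-trans (Sat-unmarkedᶠ X $t)
        (mk⇔ (λ unmarked idx x<i i<n → unmarked idx x<i (from <$⇔<n i<n)) (λ unmarked idx x<i i<$ → unmarked idx x<i (to <$⇔<n i<$)))

      Sat-unmarkedBelow$ᶠ : Sat emptyW noRels (unmarkedBelowᶠ $t ts) ρ ⇔ Unmarked t 0 n
      Sat-unmarkedBelow$ᶠ = ⇔-trans (Sat-unmarkedBelowᶠ $t)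
        (mk⇔ (λ unmarked idx 0≤i i<n → unmarked idx 0≤i (from <$⇔<n i<n)) (λ unmarked idx 0≤i i<$ → unmarked idx 0≤i (to <$⇔<n i<$)))

    Sat-initᶠ : ∀ (f : Fin (suc (suc (k * 2))) → Dom n) a →
      Sat emptyW noRels (initᶠ a (var zero) (var (suc zero)) (λ i → var (suc (suc i)))) f ⇔
      AuxHolds emptyW a (f zero) (f (suc zero)) (λ i → f (suc (suc i)))
    Sat-initᶠ f (between , p , q) =
      ⇔-trans (mk⇔ id id ×-⇔ Sat-unmarkedᶠ f ts (var zero) (var (suc zero)) ×-⇔ Sat-decide emptyW noRels (path? p [] q) f)
              (⇔-sym (Initial.Between-empty _))
      where ts = λ (i : Fin (k * 2)) → var (suc (suc i))
    Sat-initᶠ f (prefix , _ , q) =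
      ⇔-trans (Sat-unmarkedBelowᶠ f ts (var (suc zero)) ×-⇔ Sat-decide emptyW noRels (path? start [] q) f)
              (⇔-sym (Initial.Prefix-empty _))
      where ts = λ (i : Fin (k * 2)) → var (suc (suc i))
    Sat-initᶠ f (suffix , p , _) =
      ⇔-trans (<$⇔<n ×-⇔ Sat-unmarked$ᶠ f ts (var zero) ×-⇔ Sat-acceptingEndᶠ f ts p)
              (⇔-sym (Initial.Suffix-empty _))
      where ts = λ (i : Fin (k * 2)) → var (suc (suc i))

    Sat-initOutᶠ : ∀ t → Sat emptyW noRels (initOutᶠ var) t ⇔ Accepting emptyW t
    Sat-initOutᶠ t =
      ⇔-trans (Sat-orderedᶠ emptyW noRels t var ×-⇔ Sat-unmarkedBelow$ᶠ t var ×-⇔ Sat-acceptingEndᶠ t var start)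
              (⇔-sym (Initial.Accepting-empty t))

  ≢dollar⇒< : ∀ {i : Dom n} → i ≢ dollar n → toℕ i ℕ.< n
  ≢dollar⇒< {i} i≢$ = ℕₚ.≤∧≢⇒< (Finₚ.toℕ≤pred[n] i) λ i≡n → i≢$ (Finₚ.toℕ-injective (trans i≡n (sym (Finₚ.toℕ-fromℕ n))))

  allowed-≢dollar : ∀ {w : WordS s n} → w (dollar n) ≡ nothing → ∀ op i → Allowed w op i → i ≢ dollar n
  allowed-≢dollar w$ (ins a) i (i≢$ , _) = i≢$
  allowed-≢dollar w$ reset i wi≢ε refl = wi≢ε w$

  applyW-dollar : ∀ (w : WordS s n) → w (dollar n) ≡ nothing → ∀ op {i} → i ≢ dollar n → applyW w op i (dollar n) ≡ nothing
  applyW-dollar w w$ op i≢$ = trans (applyW-other w op (i≢$ ∘ sym)) w$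

  reach-invariant : ∀ {w R} → Reach program n w R → Invariant w R
  reach-invariant initial = refl , Init.Sat-initOutᶠ , λ j f → Init.Sat-initᶠ f (decode j)
  reach-invariant (step {w} {R} op i reach allowed)
    with inv@(w$ , _ , _) ← reach-invariant reach =
    applyW-dollar w w$ op i≢$ , Step.Sat-updateOutᶠ w R inv op i i<n , λ j f → Step.Sat-updateᶠ w R inv op i i<n f (decode j)
    where
    i≢$ = allowed-≢dollar w$ op i allowed
    i<n = ≢dollar⇒< i≢$

-- Runs versus ref-words

module Decomposition {s k : ℕ} (A : VSA s k) (n : ℕ) (w : WordS s n) (t : Fin (k * 2) → Dom n) where
  open VSA A
  open RefWords {s} {k}
  open Automaton A
  open Runs A n
  open Annotation {s} {k}
  open Positions w

  Blocks : ℕ → ℕ → List Sym → Set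
  Blocks a zero ρ = ρ ≡ []
  Blocks a (suc len) ρ = ∃[ v ] ∃[ ρ′ ] ρ ≡ (v ++ readLetter (W a)) ++ ρ′
                       × MarkersAllowed (markersAt t a) (W a) (isEnd a) × OpsFor (markersAt t a) v × Blocks (suc a) len ρ′

  Run⇔Blocks : ∀ p q a len → Run w t p q a len ⇔ (∃[ ρ ] Blocks a len ρ × Path A p ρ q)
  Run⇔Blocks p q a zero = mk⇔ (λ π → [] , refl , π) (λ { (_ , refl , π) → π })
  Run⇔Blocks p q a (suc len) = mk⇔
    (λ (m , (ok , v , ops , π₁) , r) → let (ρ′ , blocks , π₂) = to (Run⇔Blocks m q (suc a) len) r
                                       in (v ++ readLetter (W a)) ++ ρ′ , (v , ρ′ , refl , ok , ops , blocks) , Path-++⁺ π₁ π₂)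
    (λ { (_ , (v , ρ′ , refl , ok , ops , blocks) , π) → let (m , π₁ , π₂) = Path-++⁻ (v ++ readLetter (W a)) π
                                                         in m , (ok , v , ops , π₁) , from (Run⇔Blocks m q (suc a) len) (ρ′ , blocks , π₂) })

  #letters : Maybe (Fin s) → ℕ
  #letters c = length (fromMaybe c)

  annotate-readLetter : ∀ c i → annotate (readLetter c) i ≡ []
  annotate-readLetter (just _) i = refl
  annotate-readLetter nothing i = refl

  nLetters-readLetter : ∀ c → nLetters (readLetter c) ≡ #letters c
  nLetters-readLetter (just _) = refl
  nLetters-readLetter nothing = refl

  clr-readLetter : ∀ c → clr (readLetter c) ≡ fromMaybe c
  clr-readLetter (just _) = refl
  clr-readLetter nothing = refl

  -- The annotated operations on x that the blocks of positions a, …, a + len - 1 must contain.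
  expectedOps : Fin k → ℕ → ℕ → ℕ → List (Sym × ℕ)
  expectedOps x a zero c = []
  expectedOps x a (suc len) c = at c (markerOps (markersAt t a) x) ++ expectedOps x (suc a) len (#letters (W a) + c)

  opsOn-block : ∀ x {v} l c ρ′ → All IsVarOp v →
    opsOn x (annotate ((v ++ readLetter l) ++ ρ′) c) ≡ at c (filter (onVar? x) v) ++ opsOn x (annotate ρ′ (#letters l + c))
  opsOn-block x {v} l c ρ′ ops = begin
    opsOn x (annotate ((v ++ readLetter l) ++ ρ′) c)
      ≡⟨ cong (opsOn x) (annotate-++ (v ++ readLetter l) ρ′ c) ⟩
    opsOn x (annotate (v ++ readLetter l) c ++ annotate ρ′ (c + nLetters (v ++ readLetter l)))
      ≡⟨ filter-++ (onVar? x ∘ proj₁) (annotate (v ++ readLetter l) c) _ ⟩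
    opsOn x (annotate (v ++ readLetter l) c) ++ opsOn x (annotate ρ′ (c + nLetters (v ++ readLetter l)))
      ≡⟨ cong₂ (λ l₁ c′ → opsOn x l₁ ++ opsOn x (annotate ρ′ c′)) block-ops block-letters ⟩
    opsOn x (annotate v c) ++ opsOn x (annotate ρ′ (#letters l + c))
      ≡⟨ cong (_++ _) (opsOn-annotate-ops x c ops) ⟩
    at c (filter (onVar? x) v) ++ opsOn x (annotate ρ′ (#letters l + c))
      ∎
    where
    open ≡-Reasoning
    block-ops : annotate (v ++ readLetter l) c ≡ annotate v c
    block-ops = trans (annotate-++ v (readLetter l) c) (trans (cong (annotate v c ++_) (annotate-readLetter l _)) (++-identityʳ _))
    block-letters : c + nLetters (v ++ readLetter l) ≡ #letters l + c
    block-letters = trans (cong (c +_) (trans (nLetters-++ v (readLetter l)) (cong₂ _+_ (nLetters-ops ops) (nLetters-readLetter l))))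
                          (ℕₚ.+-comm c _)

  Blocks⇒opsOn : ∀ {a len ρ} c → Blocks a len ρ → ∀ x → opsOn x (annotate ρ c) ≡ expectedOps x a len c
  Blocks⇒opsOn {len = zero} c refl x = refl
  Blocks⇒opsOn {a} {suc len} c (v , ρ′ , refl , _ , (ops , v≡) , blocks) x =
    trans (opsOn-block x (W a) c ρ′ ops) (cong₂ _++_ (cong (at c) (v≡ x)) (Blocks⇒opsOn _ blocks x))

  Blocks⇒clr : ∀ {a len ρ} → Blocks a len ρ → clr ρ ≡ lettersFrom W a len
  Blocks⇒clr {len = zero} refl = refl
  Blocks⇒clr {a} {suc len} (v , ρ′ , refl , _ , (ops , _) , blocks) = begin
    clr ((v ++ readLetter (W a)) ++ ρ′)           ≡⟨ clr-++ (v ++ readLetter (W a)) ρ′ ⟩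
    clr (v ++ readLetter (W a)) ++ clr ρ′         ≡⟨ cong (_++ clr ρ′) (clr-++ v (readLetter (W a))) ⟩
    (clr v ++ clr (readLetter (W a))) ++ clr ρ′   ≡⟨ cong₂ (λ l₁ l₂ → (l₁ ++ l₂) ++ clr ρ′) (clr-ops ops) (clr-readLetter (W a)) ⟩
    fromMaybe (W a) ++ clr ρ′                     ≡⟨ cong (fromMaybe (W a) ++_) (Blocks⇒clr blocks) ⟩
    lettersFrom W a (suc len)                     ∎
    where open ≡-Reasoning

  Hx Cx : Fin k → ℕ
  Hx x = toℕ (t (openIx x))
  Cx x = toℕ (t (closeIx x))

  markerOps-none : ∀ {x i} → Hx x ≢ i → Cx x ≢ i → markerOps (markersAt t i) x ≡ []
  markerOps-none {x} {i} H≢i C≢i rewrite dec-false (Hx x ℕ.≟ i) H≢i | dec-false (Cx x ℕ.≟ i) C≢i = refl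

  markerOps-open : ∀ {x i} → Hx x ≡ i → Cx x ≢ i → markerOps (markersAt t i) x ≡ opn x ∷ []
  markerOps-open {x} {i} H≡i C≢i rewrite dec-true (Hx x ℕ.≟ i) H≡i | dec-false (Cx x ℕ.≟ i) C≢i = refl

  markerOps-close : ∀ {x i} → Hx x ≢ i → Cx x ≡ i → markerOps (markersAt t i) x ≡ cls x ∷ []
  markerOps-close {x} {i} H≢i C≡i rewrite dec-false (Hx x ℕ.≟ i) H≢i | dec-true (Cx x ℕ.≟ i) C≡i = refl

  markerOps-both : ∀ {x i} → Hx x ≡ i → Cx x ≡ i → markerOps (markersAt t i) x ≡ opn x ∷ cls x ∷ []
  markerOps-both {x} {i} H≡i C≡i rewrite dec-true (Hx x ℕ.≟ i) H≡i | dec-true (Cx x ℕ.≟ i) C≡i = refl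

  offset-step : ∀ {a C} c → a ℕ.< C → count W a (C ∸ a) + c ≡ count W (suc a) (C ∸ suc a) + (#letters (W a) + c)
  offset-step {a} {C} c a<C rewrite ℕₚ.+-∸-assoc 1 a<C | length-++ (fromMaybe (W a)) {lettersFrom W (suc a) (C ∸ suc a)} =
    trans (cong (_+ c) (ℕₚ.+-comm (#letters (W a)) _)) (ℕₚ.+-assoc _ (#letters (W a)) c)

  offset-here : ∀ {a} c → count W a (a ∸ a) + c ≡ c
  offset-here {a} c rewrite ℕₚ.n∸n≡0 a = refl

  expectedOps-past : ∀ x {a} len c → Hx x ℕ.< a → Cx x ℕ.< a → expectedOps x a len c ≡ []
  expectedOps-past x zero c H<a C<a = refl
  expectedOps-past x {a} (suc len) c H<a C<a
    rewrite markerOps-none {x} {a} (ℕₚ.<⇒≢ H<a) (ℕₚ.<⇒≢ C<a) = expectedOps-past x len _ (ℕₚ.m<n⇒m<1+n H<a) (ℕₚ.m<n⇒m<1+n C<a)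

  expectedOps-close : ∀ x {a} len c → Hx x ℕ.< a → a ℕ.≤ Cx x → Cx x ℕ.< a + len →
                      expectedOps x a len c ≡ (cls x , count W a (Cx x ∸ a) + c) ∷ []
  expectedOps-close x {a} zero c H<a a≤C C< = contradiction (subst (Cx x ℕ.<_) (ℕₚ.+-identityʳ a) C<) (ℕₚ.≤⇒≯ a≤C)
  expectedOps-close x {a} (suc len) c H<a a≤C C< with ℕₚ.m≤n⇒m<n∨m≡n a≤C
  ... | inj₁ a<C rewrite markerOps-none {x} {a} (ℕₚ.<⇒≢ H<a) (ℕₚ.<⇒≢ a<C ∘ sym) =
    trans (expectedOps-close x len _ (ℕₚ.m<n⇒m<1+n H<a) a<C (subst (Cx x ℕ.<_) (ℕₚ.+-suc a len) C<))
          (cong (λ i → (cls x , i) ∷ []) (sym (offset-step c a<C)))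
  ... | inj₂ refl rewrite markerOps-close {x} {a} (ℕₚ.<⇒≢ H<a) refl | offset-here {a} c =
    cong ((cls x , c) ∷_) (expectedOps-past x len _ (ℕₚ.m<n⇒m<1+n H<a) (ℕₚ.n<1+n a))

  expectedOps-span : ∀ x {a} len c → a ℕ.≤ Hx x → Hx x ℕ.≤ Cx x → Cx x ℕ.< a + len →
    expectedOps x a len c ≡ (opn x , count W a (Hx x ∸ a) + c) ∷ (cls x , count W a (Cx x ∸ a) + c) ∷ []
  expectedOps-span x {a} zero c a≤H H≤C C< =
    contradiction (subst (Cx x ℕ.<_) (ℕₚ.+-identityʳ a) C<) (ℕₚ.≤⇒≯ (ℕₚ.≤-trans a≤H H≤C))
  expectedOps-span x {a} (suc len) c a≤H H≤C C< with ℕₚ.m≤n⇒m<n∨m≡n a≤H | ℕₚ.m≤n⇒m<n∨m≡n H≤C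
  ... | inj₁ a<H | _ rewrite markerOps-none {x} {a} (ℕₚ.<⇒≢ a<H ∘ sym) (ℕₚ.<⇒≢ (ℕₚ.<-≤-trans a<H H≤C) ∘ sym) =
    trans (expectedOps-span x len _ a<H H≤C (subst (Cx x ℕ.<_) (ℕₚ.+-suc a len) C<))
          (cong₂ (λ i j → (opn x , i) ∷ (cls x , j) ∷ []) (sym (offset-step c a<H)) (sym (offset-step c (ℕₚ.<-≤-trans a<H H≤C))))
  ... | inj₂ refl | inj₁ H<C rewrite markerOps-open {x} {a} refl (ℕₚ.<⇒≢ H<C ∘ sym) | offset-here {a} c =
    cong ((opn x , c) ∷_) (trans (expectedOps-close x len _ (ℕₚ.n<1+n a) H<C (subst (Cx x ℕ.<_) (ℕₚ.+-suc a len) C<))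
                                 (cong (λ i → (cls x , i) ∷ []) (sym (offset-step c H<C))))
  ... | inj₂ refl | inj₂ H≡C rewrite markerOps-both {x} {a} refl (sym H≡C) | sym H≡C | offset-here {a} c =
    cong (λ l → (opn x , c) ∷ (cls x , c) ∷ l) (expectedOps-past x len _ (ℕₚ.n<1+n a) (subst (ℕ._< suc a) H≡C (ℕₚ.n<1+n a)))

  expectedOps-word : ∀ x → Hx x ℕ.≤ Cx x →
    expectedOps x 0 (suc n) 1 ≡ (opn x , suc (count W 0 (Hx x))) ∷ (cls x , suc (count W 0 (Cx x))) ∷ []
  expectedOps-word x H≤C =
    trans (expectedOps-span x (suc n) 1 z≤n H≤C (s≤s (Finₚ.toℕ≤pred[n] (t (closeIx x)))))
          (cong₂ (λ i j → (opn x , i) ∷ (cls x , j) ∷ []) (ℕₚ.+-comm _ 1) (ℕₚ.+-comm _ 1))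

  clr-∷⁻ : ∀ ρ {b rest} → clr ρ ≡ b ∷ rest → ∃[ v ] ∃[ ρ′ ] ρ ≡ v ++ lsym b ∷ ρ′ × All IsVarOp v × clr ρ′ ≡ rest
  clr-∷⁻ (lsym a ∷ ρ) refl = [] , ρ , refl , [] , refl
  clr-∷⁻ (opn y ∷ ρ) eq′ with v , ρ′ , ρ≡ , ops , rest ← clr-∷⁻ ρ eq′ = opn y ∷ v , ρ′ , cong (opn y ∷_) ρ≡ , tt ∷ ops , rest
  clr-∷⁻ (cls y ∷ ρ) eq′ with v , ρ′ , ρ≡ , ops , rest ← clr-∷⁻ ρ eq′ = cls y ∷ v , ρ′ , cong (cls y ∷_) ρ≡ , tt ∷ ops , rest

  clr-[]⁻ : ∀ ρ → clr ρ ≡ [] → All IsVarOp ρ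
  clr-[]⁻ [] _ = []
  clr-[]⁻ (opn y ∷ ρ) none = tt ∷ clr-[]⁻ ρ none
  clr-[]⁻ (cls y ∷ ρ) none = tt ∷ clr-[]⁻ ρ none

  annotate-≥ : ∀ l c → All ((c ℕ.≤_) ∘ proj₂) (annotate l c)
  annotate-≥ [] c = []
  annotate-≥ (lsym _ ∷ l) c = All.map ℕₚ.<⇒≤ (annotate-≥ l (suc c))
  annotate-≥ (opn _ ∷ l) c = ℕₚ.≤-refl ∷ annotate-≥ l c
  annotate-≥ (cls _ ∷ l) c = ℕₚ.≤-refl ∷ annotate-≥ l c

  at-index : ∀ c (v : List Sym) → All ((_≡ c) ∘ proj₂) (at c v)
  at-index c v = map⁺ (All.universal (λ _ → refl) v)

  expectedOps-≥ : ∀ x a len c → All ((c ℕ.≤_) ∘ proj₂) (expectedOps x a len c)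
  expectedOps-≥ x a zero c = []
  expectedOps-≥ x a (suc len) c = ++⁺ (All.map (ℕₚ.≤-reflexive ∘ sym) (at-index c _))
                                       (All.map (ℕₚ.≤-trans (ℕₚ.m≤n+m c _)) (expectedOps-≥ x (suc a) len _))

  silent-opsOn⇒[] : ∀ ρ c → clr ρ ≡ [] → (∀ x → opsOn x (annotate ρ c) ≡ []) → ρ ≡ []
  silent-opsOn⇒[] [] c _ _ = refl
  silent-opsOn⇒[] (opn y ∷ ρ) c _ none with () ← trans (sym (filter-accept (onVar? y ∘ proj₁) {opn y , c} {annotate ρ c} refl)) (none y)
  silent-opsOn⇒[] (cls y ∷ ρ) c _ none with () ← trans (sym (filter-accept (onVar? y ∘ proj₁) {cls y , c} {annotate ρ c} refl)) (none y)

  markersAt-beyond : ∀ {i} → n ℕ.< i → ∀ idx → markersAt t i idx ≡ false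
  markersAt-beyond n<i idx = dec-false (toℕ (t idx) ℕ.≟ _) λ e → ℕₚ.<⇒≱ n<i (subst (ℕ._≤ n) e (Finₚ.toℕ≤pred[n] (t idx)))

  W-beyond : ∀ {i} → n ℕ.< i → W i ≡ nothing
  W-beyond = atℕ-≥ w _

  Blocks-beyond : ∀ a len → n ℕ.< a → Blocks a len []
  Blocks-beyond a zero n<a = refl
  Blocks-beyond a (suc len) n<a rewrite W-beyond n<a | dec-false (a ℕ.≟ n) (ℕₚ.<⇒≢ n<a ∘ sym) =
    [] , [] , refl , markersAt-beyond n<a , ([] , λ x → sym (markerOps-silent (markersAt-beyond n<a) x)) ,
    Blocks-beyond (suc a) len (ℕₚ.m<n⇒m<1+n n<a)

  module _ (allowed : ∀ i → MarkersAllowed (markersAt t i) (W i) (isEnd i)) where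

    opsOn⇒Blocks : ∀ len a c ρ → clr ρ ≡ lettersFrom W a len →
                   (∀ x → opsOn x (annotate ρ c) ≡ expectedOps x a len c) → Blocks a len ρ
    opsOn⇒Blocks zero a c ρ letters ops = silent-opsOn⇒[] ρ c letters ops
    opsOn⇒Blocks (suc len) a c ρ letters ops with W a in Wa
    ... | just b with v , ρ′ , refl , v-ops , letters′ ← clr-∷⁻ ρ letters =
      v , ρ′ , sym (++-assoc v (lsym b ∷ []) ρ′) , subst (λ l → MarkersAllowed _ l _) Wa (allowed a) ,
      (v-ops , λ x → map-injective (cong proj₁) (proj₁ (split x))) ,
      opsOn⇒Blocks len (suc a) (suc c) ρ′ letters′ (proj₂ ∘ split)
      where
      split : ∀ x → at c (filter (onVar? x) v) ≡ at c (markerOps (markersAt t a) x)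
                  × opsOn x (annotate ρ′ (suc c)) ≡ expectedOps x (suc a) len (suc c)
      split x = ++-split-at-index c (at-index c _) (at-index c _) (filter⁺ (onVar? x ∘ proj₁) (annotate-≥ ρ′ (suc c))) (expectedOps-≥ x (suc a) len (suc c))
                  (trans (sym (subst (λ ρ″ → opsOn x (annotate ρ″ c) ≡ _) (++-assoc v (lsym b ∷ []) ρ′) (opsOn-block x (just b) c ρ′ v-ops)))
                         (ops x))
    ... | nothing with a ℕ.≟ n
    ...   | yes refl =
      ρ , [] , sym (trans (++-identityʳ _) (++-identityʳ ρ)) , subst (λ l → MarkersAllowed _ l _) Wa (allowed n) ,
      (ρ-ops , λ x → map-injective (cong proj₁) (ops-at-end x)) , Blocks-beyond (suc n) len (ℕₚ.n<1+n n)
      where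
      ρ-ops : All IsVarOp ρ
      ρ-ops = clr-[]⁻ ρ (trans letters (lettersFrom-nothing (suc n) len λ i → W-beyond))
      ops-at-end : ∀ x → at c (filter (onVar? x) ρ) ≡ at c (markerOps (markersAt t n) x)
      ops-at-end x = begin
        at c (filter (onVar? x) ρ)                                  ≡⟨ opsOn-annotate-ops x c ρ-ops ⟨
        opsOn x (annotate ρ c)                                      ≡⟨ ops x ⟩
        at c (markerOps (markersAt t n) x) ++ expectedOps x (suc n) len c
                                                                    ≡⟨ cong (_ ++_) (expectedOps-past x len c (s≤s (Finₚ.toℕ≤pred[n] _)) (s≤s (Finₚ.toℕ≤pred[n] _))) ⟩
        at c (markerOps (markersAt t n) x) ++ []                    ≡⟨ ++-identityʳ _ ⟩
        at c (markerOps (markersAt t n) x)                          ∎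
        where open ≡-Reasoning
    ...   | no a≢n =
      [] , ρ , refl , subst (MarkersAllowed (markersAt t a) nothing) (sym (dec-false (a ℕ.≟ n) a≢n)) silent-here , ([] , λ x → sym (markerOps-silent silent-here x)) ,
      opsOn⇒Blocks len (suc a) c ρ letters λ x → trans (ops x) (cong (λ l → at c l ++ expectedOps x (suc a) len c) (markerOps-silent silent-here x))
      where
      silent-here : ∀ i → markersAt t a i ≡ false
      silent-here = subst (MarkersAllowed (markersAt t a) nothing) (dec-false (a ℕ.≟ n) a≢n) (subst (λ l → MarkersAllowed _ l _) Wa (allowed a))

  Blocks-allowed : ∀ {a len ρ} → Blocks a len ρ → ∀ i → a ℕ.≤ i → i ℕ.< a + len → MarkersAllowed (markersAt t i) (W i) (isEnd i)
  Blocks-allowed {a} {zero} blocks i a≤i i< = contradiction (subst (i ℕ.<_) (ℕₚ.+-identityʳ a) i<) (ℕₚ.≤⇒≯ a≤i)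
  Blocks-allowed {a} {suc len} (_ , _ , _ , ok , _ , blocks) i a≤i i< with ℕₚ.m≤n⇒m<n∨m≡n a≤i
  ... | inj₁ a<i = Blocks-allowed blocks i a<i (subst (i ℕ.<_) (ℕₚ.+-suc a len) i<)
  ... | inj₂ refl = ok

  opening-at-symbol : ∀ {i} x → MarkersAllowed (markersAt t i) (W i) (isEnd i) → Hx x ≡ i → W i ≢ nothing
  opening-at-symbol {i} x ok H≡i Wi≡ε = contradiction (trans (sym (dec-true (Hx x ℕ.≟ i) H≡i)) (no-opening (isEnd i) (subst (λ l → MarkersAllowed _ l _) Wi≡ε ok))) λ ()
    where
    no-opening : ∀ e → MarkersAllowed (markersAt t i) nothing e → markersAt t i (openIx x) ≡ false
    no-opening false ok = ok (openIx x)
    no-opening true ok = ok x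

  closing-at-symbol-or-end : ∀ {i} x → MarkersAllowed (markersAt t i) (W i) (isEnd i) → Cx x ≡ i → W i ≡ nothing → i ≡ n
  closing-at-symbol-or-end {i} x ok C≡i Wi≡ε with i ℕ.≟ n
  ... | yes i≡n = i≡n
  ... | no i≢n = contradiction (trans (sym (dec-true (Cx x ℕ.≟ i) C≡i)) (silent (closeIx x))) λ ()
    where
    silent : ∀ idx → markersAt t i idx ≡ false
    silent = subst₂ (MarkersAllowed (markersAt t i)) Wi≡ε (dec-false (i ℕ.≟ n) i≢n) ok

module Correspondence {s k : ℕ} (A : VSA s k) (n : ℕ) (w : WordS s n) (w$ : w (dollar n) ≡ nothing) (t : Fin (k * 2) → Dom n) where
  open VSA A
  open RefWords {s} {k}
  open Runs A n
  open Annotation {s} {k}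
  open Positions w
  open Decomposition A n w t

  Endpoints : Dom n × Dom n → Span → Set
  Endpoints (xh , xc) (i , j) = (IsSymbol w xh × pos w xh ≡ i)
                              × ((IsSymbol w xc × pos w xc ≡ j) ⊎ (j ≡ suc (length (word w)) × xc ≡ dollar n))

  SpannerRel⇔ : SpannerRel A w t ⇔ (∃[ μ ] ⟦ A ⟧ (word w) μ × ∀ x → Endpoints (t (openIx x) , t (closeIx x)) (μ x))
  SpannerRel⇔ = mk⇔ (λ (μ , acc , ends) → μ , acc , λ x → subst (λ pr → Endpoints pr (μ x)) (pairs-ix k t x) (ends x))
                    (λ (μ , acc , ends) → μ , acc , λ x → subst (λ pr → Endpoints pr (μ x)) (sym (pairs-ix k t x)) (ends x))

  μₜ : Fin k → Span
  μₜ x = suc (count W 0 (Hx x)) , suc (count W 0 (Cx x))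

  toℕ≡n⇒dollar : ∀ {d : Dom n} → toℕ d ≡ n → d ≡ dollar n
  toℕ≡n⇒dollar d≡n = Finₚ.toℕ-injective (trans d≡n (sym (Finₚ.toℕ-fromℕ n)))

  Accepting⇒SpannerRel : Accepting w t → SpannerRel A w t
  Accepting⇒SpannerRel (ordered , qf , final , seg) with ρ , blocks , π ← to (Run⇔Blocks start qf 0 (suc n)) seg =
    from SpannerRel⇔ (μₜ , (ρ , (qf , π , final) , trans (Blocks⇒clr blocks) (sym word-letters) , spans) , ends)
    where
    allowed : ∀ (d : Dom n) → MarkersAllowed (markersAt t (toℕ d)) (W (toℕ d)) (isEnd (toℕ d))
    allowed d = Blocks-allowed blocks (toℕ d) z≤n (s≤s (Finₚ.toℕ≤pred[n] d))
    spans : ∀ x → VarSpan ρ x (μₜ x)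
    spans x = opsOn⇒VarSpan ρ x (trans (Blocks⇒opsOn 1 blocks x) (expectedOps-word x (ordered x)))
    ends : ∀ x → Endpoints (t (openIx x) , t (closeIx x)) (μₜ x)
    ends x = (opening , pos-symbol _ opening) , closing
      where
      opening : IsSymbol w (t (openIx x))
      opening wx≡ε = opening-at-symbol x (allowed (t (openIx x))) refl (trans (atℕ-toℕ w _) wx≡ε)
      closing : (IsSymbol w (t (closeIx x)) × pos w (t (closeIx x)) ≡ suc (count W 0 (Cx x)))
              ⊎ (suc (count W 0 (Cx x)) ≡ suc (length (word w)) × t (closeIx x) ≡ dollar n)
      closing with w (t (closeIx x)) in wx
      ... | just _ = inj₁ ((λ ()) , pos-symbol _ λ wx≡ε → case trans (sym wx) wx≡ε of λ ())
      ... | nothing = inj₂ (cong suc (trans (cong (count W 0) C≡n) (sym (length-word w$))) , toℕ≡n⇒dollar C≡n)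
        where C≡n = closing-at-symbol-or-end x (allowed (t (closeIx x))) refl (trans (atℕ-toℕ w _) wx)

  private
    closing-position : ∀ {x j} → (IsSymbol w (t (closeIx x)) × pos w (t (closeIx x)) ≡ j)
                                ⊎ (j ≡ suc (length (word w)) × t (closeIx x) ≡ dollar n) → j ≡ suc (count W 0 (Cx x))
    closing-position (inj₁ (symbol , pos≡j)) = trans (sym pos≡j) (pos-symbol _ symbol)
    closing-position {x} (inj₂ (j≡ , x≡$)) =
      trans j≡ (cong suc (trans (length-word w$) (cong (count W 0) (sym (trans (cong toℕ x≡$) (Finₚ.toℕ-fromℕ n))))))

  SpannerRel⇒Accepting : SpannerRel A w t → Accepting w t
  SpannerRel⇒Accepting sr with μ , (ρ , (qf , π , final) , clr≡ , spans) , ends ← to SpannerRel⇔ sr =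
    ordered , qf , final , from (Run⇔Blocks start qf 0 (suc n)) (ρ , blocks , π)
    where
    μ≡μₜ : ∀ x → μ x ≡ μₜ x
    μ≡μₜ x = ×-≡,≡→≡ (trans (sym (proj₂ (proj₁ (ends x)))) (pos-symbol _ (proj₁ (proj₁ (ends x)))) , closing-position (proj₂ (ends x)))

    counts-ordered : ∀ x → count W 0 (Hx x) ℕ.≤ count W 0 (Cx x)
    counts-ordered x = ℕₚ.≤-pred (subst₂ ℕ._≤_ (cong proj₁ (μ≡μₜ x)) (cong proj₂ (μ≡μₜ x)) (VarSpan-≤ (spans x)))

    -- Positions are ordered because the count of letters strictly increases past a symbol-element.
    ordered : Ordered t
    ordered x with Hx x ℕ.≤? Cx x | proj₂ (ends x)
    ... | yes H≤C | _ = H≤C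
    ... | no H≰C | inj₂ (_ , x≡$) = contradiction (subst (Hx x ℕ.≤_) (sym (trans (cong toℕ x≡$) (Finₚ.toℕ-fromℕ n))) (Finₚ.toℕ≤pred[n] _)) H≰C
    ... | no H≰C | inj₁ (symbol , _) = ⊥-elim (ℕₚ.<-irrefl refl (ℕₚ.<-≤-trans count-C<count-sucC (ℕₚ.≤-trans (count-mono W (ℕₚ.≰⇒> H≰C)) (counts-ordered x))))
      where
      count-C<count-sucC : count W 0 (Cx x) ℕ.< count W 0 (suc (Cx x))
      count-C<count-sucC = subst (count W 0 (Cx x) ℕ.<_) (trans (sym (pos-symbol _ symbol)) (pos-count (t (closeIx x)))) (ℕₚ.n<1+n _)

    opening-not-at : ∀ {i} x → W i ≡ nothing → Hx x ≢ i
    opening-not-at x Wi≡ε refl = proj₁ (proj₁ (ends x)) (trans (sym (atℕ-toℕ w _)) Wi≡ε)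

    closing-not-before-end : ∀ {i} x → W i ≡ nothing → i ≢ n → Cx x ≢ i
    closing-not-before-end x Wi≡ε i≢n refl with proj₂ (ends x)
    ... | inj₁ (symbol , _) = symbol (trans (sym (atℕ-toℕ w _)) Wi≡ε)
    ... | inj₂ (_ , x≡$) = i≢n (trans (cong toℕ x≡$) (Finₚ.toℕ-fromℕ n))

    allowed : ∀ i → MarkersAllowed (markersAt t i) (W i) (isEnd i)
    allowed i with W i in Wi | i ℕ.≟ n
    ... | just _ | _ = tt
    ... | nothing | yes refl rewrite dec-true (i ℕ.≟ i) refl =
      λ x → dec-false (Hx x ℕ.≟ i) (opening-not-at x Wi)
    ... | nothing | no i≢n rewrite dec-false (i ℕ.≟ n) i≢n = λ idx → case openIx-or-closeIx {k} idx of λ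
      { (x , inj₁ refl) → dec-false (Hx x ℕ.≟ i) (opening-not-at x Wi)
      ; (x , inj₂ refl) → dec-false (Cx x ℕ.≟ i) (closing-not-before-end x Wi i≢n) }

    blocks : Blocks 0 (suc n) ρ
    blocks = opsOn⇒Blocks allowed (suc n) 0 1 ρ (trans clr≡ word-letters) λ x →
      trans (VarSpan⇒opsOn ρ x (subst (VarSpan ρ x) (μ≡μₜ x) (spans x))) (sym (expectedOps-word x (ordered x)))

  Accepting⇔SpannerRel : Accepting w t ⇔ SpannerRel A w t
  Accepting⇔SpannerRel = mk⇔ Accepting⇒SpannerRel SpannerRel⇒Accepting

mainTheorem16 : ∀ {s k : _} (A : VSA s k) → MaintainableInDynPROP s k (SpannerRel A)
mainTheorem16 A = program , program-QF , zero , refl , λ n w R reach t →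
  let (w$ , outputs-accepting , _) = Maintenance.reach-invariant A n reach
  in ⇔-trans (outputs-accepting t) (Correspondence.Accepting⇔SpannerRel A n w w$ t)
  where open Program A
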